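{- Let $0\le l\le n-2$ and let $T_{n-l,l}$ be the tadpole obtained by joining a vertex of the cycle $C_{n-l}$ to an end vertex of the path $P_l$ by an edge (for $l=0$, $T_{n,0}=C_n$). Then \[ X_{T_{n-l,l}}=\sum_{I\vDash n}\Theta_I^+(l+1)\,w_I\,e_I . \]
   Context: A composition $I=i_1\cdots i_s\vDash n$ is a sequence of positive integers with sum $n$; $e_I$ denotes the elementary symmetric function $e_{i_1}e_{i_2}\cdots e_{i_s}$. Define $w_I=i_1\prod_{j\ge2}(i_j-1)$. For $0\le a\le n$, let $\sigma_I^+(a)=\min\{i_1+\dots+i_k:0\le k\le s,\ i_1+\dots+i_k\ge a\}$ and $\Theta_I^+(a)=\sigma_I^+(a)-a$. $C_m$ is the cycle on $m$ vertices ($C_2$ being two vertices joined by an edge), $P_l$ the path on $l$ vertices. The chromatic symmetric function of a graph $G$ is $X_G=\sum_\kappa\prod_{v\in V(G)}x_{\kappa(v)}$ over proper colorings $\kappa:V(G)\to\{1,2,\dots\}$. -}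

module Defs where

open import Data.Nat using (ℕ; zero; suc; _+_; _*_; _∸_; _⊓_; _≤ᵇ_; _≡ᵇ_)
open import Data.Bool using (Bool; true; false; not; _∧_; if_then_else_)
open import Data.List using (List; []; _∷_; map; foldr; filter; concatMap; upTo; applyUpTo)
open import Data.Nat.ListAction using (sum; product)
open import Data.Bool.ListAction using (all)
open import Data.Product using (_×_; _,_; proj₁; proj₂)
open import Data.Integer as ℤ using (ℤ; +_)
open import Relation.Nullary.Decidable using (yes; no)
import Data.Nat as ℕ

record Graph : Set where
  constructor graph
  field
    vertices : ℕ                 -- vertex set {0, …, vertices-1}
    edges    : List (ℕ × ℕ)       -- each edge joins two vertices < vertices
open Graph public

-- The tadpole T_{n-l,l}: cycle C_{n-l} on vertices 0,…,n-l-1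
-- (edges {i,i+1} for i+1 < n-l, plus {0, n-l-1}); path P_l on vertices
-- n-l,…,n-1 (edges {i,i+1}); vertex n-l-1 of the cycle joined to the end
-- vertex n-l of the path by the edge {n-l-1, n-l}.  For n-l = 2 the closing
-- edge duplicates {0,1}, which is C_2 (irrelevant for proper colourings).
tadpole : ℕ → ℕ → Graph
tadpole n l = graph n ((0 , (n ∸ l) ∸ 1) ∷ applyUpTo (λ i → (i , suc i)) (n ∸ 1))

-- Colourings with colours {0,…,N-1}: lists κ of length n, κ[v] = colour of v.

words : ℕ → ℕ → List (List ℕ)
words N zero    = [] ∷ []
words N (suc k) = concatMap (λ c → map (c ∷_) (words N k)) (upTo N)

nth : List ℕ → ℕ → ℕ
nth []      _       = 0
nth (a ∷ _) zero    = a
nth (_ ∷ as) (suc i) = nth as i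

proper : Graph → List ℕ → Bool
proper G κ = all (λ e → not (nth κ (proj₁ e) ≡ᵇ nth κ (proj₂ e))) (edges G)

-- Chromatic symmetric function X_G specialised to the N variables
-- x 0, …, x (N-1) (all other variables set to 0):
-- sum over proper colourings κ : V(G) → {0,…,N-1} of ∏_v x_{κ(v)}.
X : Graph → (N : ℕ) → (ℕ → ℤ) → ℤ
X G N x = foldr ℤ._+_ (+ 0)
  (map (λ κ → if proper G κ then foldr ℤ._*_ (+ 1) (map x κ) else + 0)
       (words N (vertices G)))

esym : List ℤ → ℕ → ℤ
esym []       zero    = + 1
esym []       (suc k) = + 0
esym (y ∷ ys) zero    = + 1
esym (y ∷ ys) (suc k) = y ℤ.* esym ys k ℤ.+ esym ys (suc k)

eI : List ℕ → (N : ℕ) → (ℕ → ℤ) → ℤ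
eI I N x = foldr ℤ._*_ (+ 1) (map (esym (map x (upTo N))) I)

positiveWords : ℕ → ℕ → List (List ℕ)
positiveWords n k = map (map suc) (words n k)

compositions : ℕ → List (List ℕ)
compositions n =
  filter (λ I → sum I ℕ.≟ n) (concatMap (positiveWords n) (upTo (suc n)))

w : List ℕ → ℕ
w []      = 1
w (i ∷ I) = i * product (map (λ j → j ∸ 1) I)

prefixSums : List ℕ → List ℕ
prefixSums []      = 0 ∷ []
prefixSums (i ∷ I) = 0 ∷ map (λ t → i + t) (prefixSums I)

-- σ⁺_I(a) = min { i_1+…+i_k : 0 ≤ k ≤ s, i_1+…+i_k ≥ a }  (for a ≤ |I|;
-- the full sum |I| belongs to the set, so it is used as the fold seed)
σ⁺ : List ℕ → ℕ → ℕ
σ⁺ I a = foldr _⊓_ (sum I) (filter (λ s → a ℕ.≤? s) (prefixSums I))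

Θ⁺ : List ℕ → ℕ → ℕ
Θ⁺ I a = σ⁺ I a ∸ a

-- Proper colourings of the tadpole T_{n-l,l} are the Smirnov words κ of length n (adjacent
-- letters distinct) with κ 0 ≠ κ (n-l-1). Joining a coloured cycle C_{n-l-1} and a coloured
-- path P_{l+1} by an edge gives a colouring of T_{n-l-1,l+1} when the ends of that edge get
-- different colours, and otherwise (moving the shared colour to the front) a colouring of P_n
-- in which vertices 0 and n-l-1 share a colour. Hence
--   X_{T_{n-l,l}} = X_{T_{n-l-1,l+1}} + X_{P_n} - X_{C_{n-l-1}} X_{P_{l+1}} .
-- The right-hand side obeys the same recurrence: Θ⁺_I(a+1) - Θ⁺_I(a) = -1 unless a is a
-- partial sum of I, and cutting the compositions of n at a produces
-- (Σ_{I ⊨ a} w_I e_I)(Σ_{J ⊨ n-a} Θ⁺_J(1) w_J e_J). Here X_{P_m} = Σ_{I ⊨ m} w_I e_I since both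
-- generating functions equal E / (E - z E′) (Newton's identity on the Smirnov side), and the
-- second factor is the cycle case l = 0 for n - a < n. Both sides vanish for l = n - 1, so an
-- induction on n - l concludes.

module Submission where

open import Defs
open import Data.Nat using (ℕ; _+_; _*_; _≤_)
open import Data.Integer as ℤ using (ℤ; +_)
open import Data.List using (foldr; map)
open import Relation.Binary.PropositionalEquality using (_≡_)

open import Data.Bool using (Bool; true; false; not; _∧_; if_then_else_; T)
open import Data.Bool.Properties using (∧-assoc; ∧-identityʳ; ∧-zeroʳ)
open import Data.Bool.ListAction using (and)
open import Data.Integer using (0ℤ; 1ℤ; _^_) renaming (_+_ to _⊕_; _*_ to _⊗_; -_ to ⊝_; _-_ to _⊖_)
import Data.Integer.Properties as ℤₚ
open import Data.Integer.Tactic.RingSolver using (solve-∀)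
open import Data.List using (List; []; _∷_; filter; concatMap; upTo; applyUpTo; _++_; length)
open import Data.List.Properties using (map-cong; map-∘; map-applyUpTo)
open import Data.Nat using (zero; suc; _∸_; _<_; z≤n; s≤s; _≡ᵇ_; _≤ᵇ_; _⊓_)
import Data.Nat as ℕ
open import Data.Nat.Induction using (<-rec)
open import Data.Nat.ListAction using (sum; product)
import Data.Nat.Properties as ℕₚ
open import Data.Product using (_,_)
open import Data.Sum using (inj₁; inj₂)
open import Data.Unit using (tt)
open import Function using (_∘_; id)
open import Relation.Binary.PropositionalEquality
  using (_≗_; refl; sym; trans; cong; cong₂; subst; module ≡-Reasoning)
open import Relation.Nullary using (does; yes; no)
open import Relation.Nullary.Decidable using (dec-true; dec-false)
open import Relation.Unary using (Decidable)

open ≡-Reasoning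

Σ< : ℕ → (ℕ → ℤ) → ℤ
Σ< zero    f = 0ℤ
Σ< (suc n) f = f 0 ⊕ Σ< n (f ∘ suc)

Σ<-cong-< : ∀ n {f g : ℕ → ℤ} → (∀ i → i < n → f i ≡ g i) → Σ< n f ≡ Σ< n g
Σ<-cong-< zero    eq = refl
Σ<-cong-< (suc n) eq = cong₂ _⊕_ (eq 0 (s≤s z≤n)) (Σ<-cong-< n (λ i i<n → eq (suc i) (s≤s i<n)))

Σ<-cong : ∀ n {f g : ℕ → ℤ} → f ≗ g → Σ< n f ≡ Σ< n g
Σ<-cong n eq = Σ<-cong-< n (λ i _ → eq i)

Σ<-zero : ∀ n {f : ℕ → ℤ} → (∀ i → i < n → f i ≡ 0ℤ) → Σ< n f ≡ 0ℤ
Σ<-zero zero    eq = refl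
Σ<-zero (suc n) eq = cong₂ _⊕_ (eq 0 (s≤s z≤n)) (Σ<-zero n (λ i i<n → eq (suc i) (s≤s i<n)))

Σ<-+ : ∀ n (f g : ℕ → ℤ) → Σ< n (λ i → f i ⊕ g i) ≡ Σ< n f ⊕ Σ< n g
Σ<-+ zero    f g = refl
Σ<-+ (suc n) f g = trans (cong (f 0 ⊕ g 0 ⊕_) (Σ<-+ n (f ∘ suc) (g ∘ suc))) (interchange (f 0) (g 0) _ _)
  where
  interchange : ∀ a b c d → a ⊕ b ⊕ (c ⊕ d) ≡ a ⊕ c ⊕ (b ⊕ d)
  interchange = solve-∀

Σ<-*ˡ : ∀ n c (f : ℕ → ℤ) → c ⊗ Σ< n f ≡ Σ< n (λ i → c ⊗ f i)
Σ<-*ˡ zero    c f = ℤₚ.*-zeroʳ c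
Σ<-*ˡ (suc n) c f = trans (ℤₚ.*-distribˡ-+ c (f 0) _) (cong (c ⊗ f 0 ⊕_) (Σ<-*ˡ n c (f ∘ suc)))

Σ<-*ʳ : ∀ n c (f : ℕ → ℤ) → Σ< n f ⊗ c ≡ Σ< n (λ i → f i ⊗ c)
Σ<-*ʳ n c f = trans (ℤₚ.*-comm (Σ< n f) c) (trans (Σ<-*ˡ n c f) (Σ<-cong n (λ i → ℤₚ.*-comm c (f i))))

Σ<-neg : ∀ n (f : ℕ → ℤ) → ⊝ Σ< n f ≡ Σ< n (λ i → ⊝ f i)
Σ<-neg zero    f = refl
Σ<-neg (suc n) f = trans (ℤₚ.neg-distrib-+ (f 0) _) (cong (⊝ f 0 ⊕_) (Σ<-neg n (f ∘ suc)))

Σ<-⊖ : ∀ n (f g : ℕ → ℤ) → Σ< n (λ i → f i ⊖ g i) ≡ Σ< n f ⊖ Σ< n g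
Σ<-⊖ n f g = trans (Σ<-+ n f (λ i → ⊝ g i)) (cong (Σ< n f ⊕_) (sym (Σ<-neg n g)))

Σ<-last : ∀ n (f : ℕ → ℤ) → Σ< (suc n) f ≡ Σ< n f ⊕ f n
Σ<-last zero    f = ℤₚ.+-comm (f 0) 0ℤ
Σ<-last (suc n) f = trans (cong (f 0 ⊕_) (Σ<-last n (f ∘ suc))) (sym (ℤₚ.+-assoc (f 0) _ _))

Σ<-vanishing-tail : ∀ m M (f : ℕ → ℤ) → m ≤ M → (∀ i → m ≤ i → f i ≡ 0ℤ) → Σ< M f ≡ Σ< m f
Σ<-vanishing-tail zero M f _ tail = Σ<-zero M (λ i _ → tail i z≤n)
Σ<-vanishing-tail (suc m) (suc M) f (s≤s m≤M) tail =
  cong (f 0 ⊕_) (Σ<-vanishing-tail m M (f ∘ suc) m≤M (λ i m≤i → tail (suc i) (s≤s m≤i)))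

Σ<-swap : ∀ m n (f : ℕ → ℕ → ℤ) → Σ< m (λ i → Σ< n (f i)) ≡ Σ< n (λ j → Σ< m (λ i → f i j))
Σ<-swap zero    n f = sym (Σ<-zero n (λ _ _ → refl))
Σ<-swap (suc m) n f = begin
  Σ< n (f 0) ⊕ Σ< m (λ i → Σ< n (f (suc i)))          ≡⟨ cong (Σ< n (f 0) ⊕_) (Σ<-swap m n (f ∘ suc)) ⟩
  Σ< n (f 0) ⊕ Σ< n (λ j → Σ< m (λ i → f (suc i) j)) ≡⟨ Σ<-+ n (f 0) _ ⟨
  Σ< n (λ j → Σ< (suc m) (λ i → f i j))              ∎

Σ<-reverse : ∀ n (f : ℕ → ℤ) → Σ< n f ≡ Σ< n (λ i → f (n ∸ suc i))
Σ<-reverse zero    f = refl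
Σ<-reverse (suc n) f = begin
  f 0 ⊕ Σ< n (f ∘ suc)
    ≡⟨ cong (f 0 ⊕_) (Σ<-reverse n (f ∘ suc)) ⟩
  f 0 ⊕ Σ< n (λ i → f (suc (n ∸ suc i)))
    ≡⟨ ℤₚ.+-comm (f 0) _ ⟩
  Σ< n (λ i → f (suc (n ∸ suc i))) ⊕ f 0
    ≡⟨ cong₂ _⊕_ (Σ<-cong-< n (λ i i<n → cong f (sym (ℕₚ.+-∸-assoc 1 i<n))))
                                                            (cong f (sym (ℕₚ.n∸n≡0 n))) ⟩
  Σ< n (λ i → f (n ∸ i)) ⊕ f (n ∸ n)
    ≡⟨ Σ<-last n (λ i → f (n ∸ i)) ⟨
  Σ< (suc n) (λ i → f (suc n ∸ suc i)) ∎

Σ<-triangle : ∀ n (F : ℕ → ℕ → ℤ) →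
  Σ< (suc n) (λ i → Σ< (suc i) (λ j → F j i)) ≡ Σ< (suc n) (λ j → Σ< (suc (n ∸ j)) (λ k → F j (j + k)))
Σ<-triangle zero    F = refl
Σ<-triangle (suc n) F = begin
  F 0 0 ⊕ 0ℤ ⊕ Σ< (suc n) (λ i → F 0 (suc i) ⊕ Σ< (suc i) (λ j → F (suc j) (suc i)))
    ≡⟨ cong (F 0 0 ⊕ 0ℤ ⊕_) (Σ<-+ (suc n) (λ i → F 0 (suc i)) (λ i → Σ< (suc i) (λ j → F (suc j) (suc i)))) ⟩
  F 0 0 ⊕ 0ℤ ⊕ (Σ< (suc n) (λ i → F 0 (suc i)) ⊕ Σ< (suc n) (λ i → Σ< (suc i) (λ j → F (suc j) (suc i))))
    ≡⟨ cong (λ t → F 0 0 ⊕ 0ℤ ⊕ (Σ< (suc n) (λ i → F 0 (suc i)) ⊕ t)) (Σ<-triangle n (λ j i → F (suc j) (suc i))) ⟩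
  F 0 0 ⊕ 0ℤ ⊕ (Σ< (suc n) (λ i → F 0 (suc i)) ⊕ Σ< (suc n) (λ j → Σ< (suc (n ∸ j)) (λ k → F (suc j) (suc (j + k)))))
    ≡⟨ reassoc (F 0 0) _ _ ⟩
  F 0 0 ⊕ Σ< (suc n) (λ i → F 0 (suc i)) ⊕ Σ< (suc n) (λ j → Σ< (suc (n ∸ j)) (λ k → F (suc j) (suc (j + k)))) ∎
  where
  reassoc : ∀ a b c → a ⊕ 0ℤ ⊕ (b ⊕ c) ≡ a ⊕ b ⊕ c
  reassoc = solve-∀

Series : Set
Series = ℕ → ℤ

_⋆_ : Series → Series → Series
(f ⋆ g) n = Σ< (suc n) (λ i → f i ⊗ g (n ∸ i))

𝟏 : Series
𝟏 zero    = 1ℤ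
𝟏 (suc n) = 0ℤ

shift : Series → Series
shift f zero    = 0ℤ
shift f (suc n) = f n

_+ₛ_ _-ₛ_ : Series → Series → Series
(f +ₛ g) n = f n ⊕ g n
(f -ₛ g) n = f n ⊖ g n

_·ₛ_ : ℤ → Series → Series
(c ·ₛ f) n = c ⊗ f n

infixr 8 _·ₛ_
infixl 7 _⋆_
infixl 6 _+ₛ_ _-ₛ_

⋆-comm : ∀ f g → f ⋆ g ≗ g ⋆ f
⋆-comm f g n = begin
  Σ< (suc n) (λ i → f i ⊗ g (n ∸ i))             ≡⟨ Σ<-reverse (suc n) (λ i → f i ⊗ g (n ∸ i)) ⟩
  Σ< (suc n) (λ i → f (n ∸ i) ⊗ g (n ∸ (n ∸ i))) ≡⟨ Σ<-cong-< (suc n) swap ⟩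
  Σ< (suc n) (λ i → g i ⊗ f (n ∸ i))             ∎
  where
  swap : ∀ i → i < suc n → f (n ∸ i) ⊗ g (n ∸ (n ∸ i)) ≡ g i ⊗ f (n ∸ i)
  swap i (s≤s i≤n) = trans (cong (λ j → f (n ∸ i) ⊗ g j) (ℕₚ.m∸[m∸n]≡n i≤n)) (ℤₚ.*-comm (f (n ∸ i)) (g i))

⋆-assoc : ∀ f g h → (f ⋆ g) ⋆ h ≗ f ⋆ (g ⋆ h)
⋆-assoc f g h n = begin
  Σ< (suc n) (λ i → Σ< (suc i) (λ j → f j ⊗ g (i ∸ j)) ⊗ h (n ∸ i))
    ≡⟨ Σ<-cong (suc n) (λ i → Σ<-*ʳ (suc i) (h (n ∸ i)) (λ j → f j ⊗ g (i ∸ j))) ⟩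
  Σ< (suc n) (λ i → Σ< (suc i) (λ j → f j ⊗ g (i ∸ j) ⊗ h (n ∸ i)))
    ≡⟨ Σ<-triangle n (λ j i → f j ⊗ g (i ∸ j) ⊗ h (n ∸ i)) ⟩
  Σ< (suc n) (λ j → Σ< (suc (n ∸ j)) (λ k → f j ⊗ g (j + k ∸ j) ⊗ h (n ∸ (j + k))))
    ≡⟨ Σ<-cong (suc n) (λ j → Σ<-cong (suc (n ∸ j)) (λ k → reindex j k)) ⟩
  Σ< (suc n) (λ j → Σ< (suc (n ∸ j)) (λ k → f j ⊗ (g k ⊗ h (n ∸ j ∸ k))))
    ≡⟨ Σ<-cong (suc n) (λ j → Σ<-*ˡ (suc (n ∸ j)) (f j) (λ k → g k ⊗ h (n ∸ j ∸ k))) ⟨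
  Σ< (suc n) (λ j → f j ⊗ (g ⋆ h) (n ∸ j)) ∎
  where
  reindex : ∀ j k → f j ⊗ g (j + k ∸ j) ⊗ h (n ∸ (j + k)) ≡ f j ⊗ (g k ⊗ h (n ∸ j ∸ k))
  reindex j k = trans (cong₂ (λ a b → f j ⊗ g a ⊗ h b) (ℕₚ.m+n∸m≡n j k) (sym (ℕₚ.∸-+-assoc n j k)))
                      (ℤₚ.*-assoc (f j) _ _)

⋆-congˡ : ∀ f {g g'} → g ≗ g' → f ⋆ g ≗ f ⋆ g'
⋆-congˡ f eq n = Σ<-cong (suc n) (λ i → cong (f i ⊗_) (eq (n ∸ i)))

⋆-congʳ : ∀ {f f'} g → f ≗ f' → f ⋆ g ≗ f' ⋆ g
⋆-congʳ g eq n = Σ<-cong (suc n) (λ i → cong (_⊗ g (n ∸ i)) (eq i))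

⋆-distribˡ-+ : ∀ f g h → f ⋆ (g +ₛ h) ≗ f ⋆ g +ₛ f ⋆ h
⋆-distribˡ-+ f g h n = trans (Σ<-cong (suc n) (λ i → ℤₚ.*-distribˡ-+ (f i) (g (n ∸ i)) (h (n ∸ i))))
                             (Σ<-+ (suc n) (λ i → f i ⊗ g (n ∸ i)) (λ i → f i ⊗ h (n ∸ i)))

⋆-distribˡ-⊖ : ∀ f g h → f ⋆ (g -ₛ h) ≗ f ⋆ g -ₛ f ⋆ h
⋆-distribˡ-⊖ f g h n = begin
  Σ< (suc n) (λ i → f i ⊗ (g (n ∸ i) ⊖ h (n ∸ i)))
    ≡⟨ Σ<-cong (suc n) (λ i → distrib (f i) (g (n ∸ i)) (h (n ∸ i))) ⟩
  Σ< (suc n) (λ i → f i ⊗ g (n ∸ i) ⊖ f i ⊗ h (n ∸ i))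
    ≡⟨ Σ<-⊖ (suc n) (λ i → f i ⊗ g (n ∸ i)) (λ i → f i ⊗ h (n ∸ i)) ⟩
  (f ⋆ g) n ⊖ (f ⋆ h) n ∎
  where
  distrib : ∀ a b c → a ⊗ (b ⊖ c) ≡ a ⊗ b ⊖ a ⊗ c
  distrib = solve-∀

⋆-distribʳ-+ : ∀ f g h → (f +ₛ g) ⋆ h ≗ f ⋆ h +ₛ g ⋆ h
⋆-distribʳ-+ f g h n = begin
  ((f +ₛ g) ⋆ h) n          ≡⟨ ⋆-comm (f +ₛ g) h n ⟩
  (h ⋆ (f +ₛ g)) n          ≡⟨ ⋆-distribˡ-+ h f g n ⟩
  (h ⋆ f) n ⊕ (h ⋆ g) n     ≡⟨ cong₂ _⊕_ (⋆-comm h f n) (⋆-comm h g n) ⟩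
  (f ⋆ h) n ⊕ (g ⋆ h) n     ∎

⋆-distribʳ-⊖ : ∀ f g h → (f -ₛ g) ⋆ h ≗ f ⋆ h -ₛ g ⋆ h
⋆-distribʳ-⊖ f g h n = begin
  ((f -ₛ g) ⋆ h) n          ≡⟨ ⋆-comm (f -ₛ g) h n ⟩
  (h ⋆ (f -ₛ g)) n          ≡⟨ ⋆-distribˡ-⊖ h f g n ⟩
  (h ⋆ f) n ⊖ (h ⋆ g) n     ≡⟨ cong₂ _⊖_ (⋆-comm h f n) (⋆-comm h g n) ⟩
  (f ⋆ h) n ⊖ (g ⋆ h) n     ∎

⋆-identityʳ : ∀ f → f ⋆ 𝟏 ≗ f
⋆-identityʳ f n = begin
  Σ< (suc n) (λ i → f i ⊗ 𝟏 (n ∸ i))                   ≡⟨ Σ<-last n _ ⟩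
  Σ< n (λ i → f i ⊗ 𝟏 (n ∸ i)) ⊕ f n ⊗ 𝟏 (n ∸ n)       ≡⟨ cong₂ _⊕_ (Σ<-zero n off-diagonal) diagonal ⟩
  0ℤ ⊕ f n                                             ≡⟨ ℤₚ.+-identityˡ (f n) ⟩
  f n                                                  ∎
  where
  off-diagonal : ∀ i → i < n → f i ⊗ 𝟏 (n ∸ i) ≡ 0ℤ
  off-diagonal i i<n = trans (cong (λ j → f i ⊗ 𝟏 j) (ℕₚ.+-∸-assoc 1 i<n)) (ℤₚ.*-zeroʳ (f i))
  diagonal : f n ⊗ 𝟏 (n ∸ n) ≡ f n
  diagonal = trans (cong (λ j → f n ⊗ 𝟏 j) (ℕₚ.n∸n≡0 n)) (ℤₚ.*-identityʳ (f n))

⋆-identityˡ : ∀ f → 𝟏 ⋆ f ≗ f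
⋆-identityˡ f n = trans (⋆-comm 𝟏 f n) (⋆-identityʳ f n)

⋆-shift : ∀ f g → f ⋆ shift g ≗ shift (f ⋆ g)
⋆-shift f g zero    = trans (ℤₚ.+-identityʳ _) (ℤₚ.*-zeroʳ (f 0))
⋆-shift f g (suc n) = begin
  Σ< (suc (suc n)) (λ i → f i ⊗ shift g (suc n ∸ i))
    ≡⟨ Σ<-last (suc n) (λ i → f i ⊗ shift g (suc n ∸ i)) ⟩
  Σ< (suc n) (λ i → f i ⊗ shift g (suc n ∸ i)) ⊕ f (suc n) ⊗ shift g (suc n ∸ suc n)
    ≡⟨ cong₂ _⊕_ (Σ<-cong-< (suc n) (λ i i<n → cong (λ j → f i ⊗ shift g j) (ℕₚ.+-∸-assoc 1 (ℕₚ.≤-pred i<n))))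
                 (trans (cong (λ j → f (suc n) ⊗ shift g j) (ℕₚ.n∸n≡0 n)) (ℤₚ.*-zeroʳ (f (suc n)))) ⟩
  (f ⋆ g) n ⊕ 0ℤ
    ≡⟨ ℤₚ.+-identityʳ _ ⟩
  (f ⋆ g) n ∎

⋆-suc : ∀ f g m → f 0 ≡ 0ℤ → (f ⋆ g) (suc m) ≡ Σ< (suc m) (λ c → f (suc c) ⊗ g (m ∸ c))
⋆-suc f g m f0≡0 = trans (cong (λ t → t ⊗ g (suc m) ⊕ Σ< (suc m) (λ c → f (suc c) ⊗ g (m ∸ c))) f0≡0)
                         (ℤₚ.+-identityˡ _)

⋆-scalarˡ : ∀ f c g → f ⋆ (c ·ₛ g) ≗ c ·ₛ (f ⋆ g)
⋆-scalarˡ f c g n = trans (Σ<-cong (suc n) (λ i → exchange (f i) c (g (n ∸ i))))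
                          (sym (Σ<-*ˡ (suc n) c (λ i → f i ⊗ g (n ∸ i))))
  where
  exchange : ∀ a b d → a ⊗ (b ⊗ d) ≡ b ⊗ (a ⊗ d)
  exchange = solve-∀

⋆-cancelʳ : ∀ {f g} h → h 0 ≡ 1ℤ → f ⋆ h ≗ g ⋆ h → f ≗ g
⋆-cancelʳ {f} {g} h h0≡1 eq n = ℤₚ.i-j≡0⇒i≡j (f n) (g n) (below (suc n) n ℕₚ.≤-refl)
  where
  K : Series
  K = f -ₛ g
  K⋆h≡0 : ∀ i → (K ⋆ h) i ≡ 0ℤ
  K⋆h≡0 i = trans (⋆-distribʳ-⊖ f g h i) (trans (cong (_⊖ (g ⋆ h) i) (eq i)) (ℤₚ.+-inverseʳ ((g ⋆ h) i)))
  step : ∀ i → (∀ j → j < i → K j ≡ 0ℤ) → K i ≡ 0ℤ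
  step i hyp = begin
    K i
      ≡⟨ ℤₚ.*-identityʳ (K i) ⟨
    K i ⊗ 1ℤ
      ≡⟨ cong (λ t → K i ⊗ t) (sym h0≡1) ⟩
    K i ⊗ h 0
      ≡⟨ ℤₚ.+-identityˡ _ ⟨
    0ℤ ⊕ K i ⊗ h 0
      ≡⟨ cong₂ _⊕_ (sym (Σ<-zero i (λ j j<i → cong (_⊗ h (i ∸ j)) (hyp j j<i))))
                                                                 (cong (λ t → K i ⊗ h t) (sym (ℕₚ.n∸n≡0 i))) ⟩
    Σ< i (λ j → K j ⊗ h (i ∸ j)) ⊕ K i ⊗ h (i ∸ i)
      ≡⟨ Σ<-last i _ ⟨
    (K ⋆ h) i
      ≡⟨ K⋆h≡0 i ⟩
    0ℤ ∎
  below : ∀ m i → i < m → K i ≡ 0ℤ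
  below (suc m) i (s≤s i≤m) with ℕₚ.m≤n⇒m<n∨m≡n i≤m
  ... | inj₁ i<m  = below m i i<m
  ... | inj₂ refl = step i (below i)

-- Newton's identity

linear : ℤ → Series
linear y = 𝟏 +ₛ y ·ₛ shift 𝟏

shift-cong : ∀ {f g} → f ≗ g → shift f ≗ shift g
shift-cong eq zero    = refl
shift-cong eq (suc n) = eq n

⋆-z : ∀ f y → f ⋆ y ·ₛ shift 𝟏 ≗ y ·ₛ shift f
⋆-z f y n = trans (⋆-scalarˡ f y (shift 𝟏) n) (cong (y ⊗_) (trans (⋆-shift f 𝟏 n) (shift-cong (⋆-identityʳ f) n)))

⋆-linear : ∀ f y → f ⋆ linear y ≗ f +ₛ y ·ₛ shift f
⋆-linear f y n = trans (⋆-distribˡ-+ f 𝟏 (y ·ₛ shift 𝟏) n) (cong₂ _⊕_ (⋆-identityʳ f n) (⋆-z f y n))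

-- The coefficients of y z / (1 + y z).
alternating : ℤ → Series
alternating y zero    = 0ℤ
alternating y (suc j) = (⊝ y) ^ j ⊗ y

alternating-⋆-linear : ∀ y → alternating y ⋆ linear y ≗ y ·ₛ shift 𝟏
alternating-⋆-linear y n = trans (⋆-linear (alternating y) y n) (telescope n)
  where
  first : ∀ y → 1ℤ ⊗ y ⊕ y ⊗ 0ℤ ≡ y ⊗ 1ℤ
  first = solve-∀
  cancel : ∀ y a → ⊝ y ⊗ a ⊗ y ⊕ y ⊗ (a ⊗ y) ≡ y ⊗ 0ℤ
  cancel = solve-∀
  telescope : ∀ n → alternating y n ⊕ y ⊗ shift (alternating y) n ≡ y ⊗ shift 𝟏 n
  telescope zero          = ℤₚ.+-identityˡ (y ⊗ 0ℤ)
  telescope (suc zero)    = first y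
  telescope (suc (suc j)) = cancel y ((⊝ y) ^ j)

signedPowerSums : List ℤ → Series
signedPowerSums []       = λ _ → 0ℤ
signedPowerSums (y ∷ ys) = alternating y +ₛ signedPowerSums ys

signedPowerSums-applyUpTo : ∀ (y : ℕ → ℤ) N j → signedPowerSums (applyUpTo y N) j ≡ Σ< N (λ b → alternating (y b) j)
signedPowerSums-applyUpTo y zero    j = refl
signedPowerSums-applyUpTo y (suc N) j = cong (alternating (y 0) j ⊕_) (signedPowerSums-applyUpTo (y ∘ suc) N j)

esym-0 : ∀ ys → esym ys 0 ≡ 1ℤ
esym-0 []       = refl
esym-0 (y ∷ ys) = refl

esym-∷ : ∀ y ys → esym (y ∷ ys) ≗ esym ys +ₛ y ·ₛ shift (esym ys)
esym-∷ y ys zero    = sym (cong₂ _⊕_ (esym-0 ys) (ℤₚ.*-zeroʳ y))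
esym-∷ y ys (suc n) = ℤₚ.+-comm (y ⊗ esym ys n) (esym ys (suc n))

z∂ : Series → Series
z∂ f n = + n ⊗ f n

z∂-linear : ∀ f y → z∂ (f +ₛ y ·ₛ shift f) ≗ z∂ f +ₛ y ·ₛ shift (z∂ f) +ₛ y ·ₛ shift f
z∂-linear f y zero    = at-zero (f 0) y
  where
  at-zero : ∀ a y → 0ℤ ⊗ (a ⊕ y ⊗ 0ℤ) ≡ 0ℤ ⊗ a ⊕ y ⊗ 0ℤ ⊕ y ⊗ 0ℤ
  at-zero = solve-∀
z∂-linear f y (suc n) = trans (cong (λ k → k ⊗ (f (suc n) ⊕ y ⊗ f n)) (ℤₚ.pos-+ 1 n)) (product-rule (+ n) (f (suc n)) y (f n))
  where
  product-rule : ∀ k a y b → (1ℤ ⊕ k) ⊗ (a ⊕ y ⊗ b) ≡ (1ℤ ⊕ k) ⊗ a ⊕ y ⊗ (k ⊗ b) ⊕ y ⊗ b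
  product-rule = solve-∀

esym-∷-⋆ : ∀ y ys → esym (y ∷ ys) ≗ esym ys ⋆ linear y
esym-∷-⋆ y ys n = trans (esym-∷ y ys n) (sym (⋆-linear (esym ys) y n))

newton : ∀ ys → z∂ (esym ys) ≗ signedPowerSums ys ⋆ esym ys
newton []       n = trans (no-variables n) (sym (Σ<-zero (suc n) (λ i _ → ℤₚ.*-zeroˡ (esym [] (n ∸ i)))))
  where
  no-variables : ∀ n → z∂ (esym []) n ≡ 0ℤ
  no-variables zero    = refl
  no-variables (suc n) = ℤₚ.*-zeroʳ (+ suc n)
newton (y ∷ ys) n = begin
  z∂ E′ n                                          ≡⟨ cong (+ n ⊗_) (esym-∷ y ys n) ⟩
  z∂ (E +ₛ y ·ₛ shift E) n                         ≡⟨ z∂-linear E y n ⟩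
  z∂ E n ⊕ y ⊗ shift (z∂ E) n ⊕ y ⊗ shift E n      ≡⟨ cong₂ (λ a b → a ⊕ y ⊗ b ⊕ y ⊗ shift E n)
                                                             (newton ys n) (shift-cong (newton ys) n) ⟩
  (π ⋆ E) n ⊕ y ⊗ shift (π ⋆ E) n ⊕ y ⊗ shift E n  ≡⟨ cong₂ _⊕_ (sym (π⋆E′ n)) (sym (α⋆E′ n)) ⟩
  (π ⋆ E′) n ⊕ (α ⋆ E′) n                          ≡⟨ ℤₚ.+-comm ((π ⋆ E′) n) ((α ⋆ E′) n) ⟩
  (α ⋆ E′) n ⊕ (π ⋆ E′) n                          ≡⟨ ⋆-distribʳ-+ α π E′ n ⟨
  (signedPowerSums (y ∷ ys) ⋆ E′) n                ∎
  where
  E E′ α π : Series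
  E  = esym ys
  E′ = esym (y ∷ ys)
  α  = alternating y
  π  = signedPowerSums ys
  π⋆E′ : π ⋆ E′ ≗ π ⋆ E +ₛ y ·ₛ shift (π ⋆ E)
  π⋆E′ n = begin
    (π ⋆ E′) n             ≡⟨ ⋆-congˡ π (esym-∷-⋆ y ys) n ⟩
    (π ⋆ (E ⋆ linear y)) n ≡⟨ ⋆-assoc π E (linear y) n ⟨
    (π ⋆ E ⋆ linear y) n   ≡⟨ ⋆-linear (π ⋆ E) y n ⟩
    (π ⋆ E +ₛ y ·ₛ shift (π ⋆ E)) n ∎
  α⋆E′ : α ⋆ E′ ≗ y ·ₛ shift E
  α⋆E′ n = begin
    (α ⋆ E′) n             ≡⟨ ⋆-congˡ α (esym-∷-⋆ y ys) n ⟩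
    (α ⋆ (E ⋆ linear y)) n ≡⟨ ⋆-congˡ α (⋆-comm E (linear y)) n ⟩
    (α ⋆ (linear y ⋆ E)) n ≡⟨ ⋆-assoc α (linear y) E n ⟨
    (α ⋆ linear y ⋆ E) n   ≡⟨ ⋆-congʳ E (alternating-⋆-linear y) n ⟩
    (y ·ₛ shift 𝟏 ⋆ E) n   ≡⟨ ⋆-comm (y ·ₛ shift 𝟏) E n ⟩
    (E ⋆ y ·ₛ shift 𝟏) n   ≡⟨ ⋆-z E y n ⟩
    y ⊗ shift E n          ∎

Σ∈ : {A : Set} → List A → (A → ℤ) → ℤ
Σ∈ L f = foldr _⊕_ 0ℤ (map f L)

module _ {A : Set} where

  Σ∈-cong : ∀ (L : List A) {f g} → f ≗ g → Σ∈ L f ≡ Σ∈ L g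
  Σ∈-cong L eq = cong (foldr _⊕_ 0ℤ) (map-cong eq L)

  Σ∈-zero : ∀ (L : List A) → Σ∈ L (λ _ → 0ℤ) ≡ 0ℤ
  Σ∈-zero []      = refl
  Σ∈-zero (a ∷ L) = trans (ℤₚ.+-identityˡ _) (Σ∈-zero L)

  Σ∈-++ : ∀ (L M : List A) f → Σ∈ (L ++ M) f ≡ Σ∈ L f ⊕ Σ∈ M f
  Σ∈-++ []      M f = sym (ℤₚ.+-identityˡ _)
  Σ∈-++ (a ∷ L) M f = trans (cong (f a ⊕_) (Σ∈-++ L M f)) (sym (ℤₚ.+-assoc (f a) _ _))

  Σ∈-+ : ∀ (L : List A) f g → Σ∈ L (λ a → f a ⊕ g a) ≡ Σ∈ L f ⊕ Σ∈ L g
  Σ∈-+ []      f g = refl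
  Σ∈-+ (a ∷ L) f g = trans (cong (f a ⊕ g a ⊕_) (Σ∈-+ L f g)) (interchange (f a) (g a) _ _)
    where
    interchange : ∀ p q r s → p ⊕ q ⊕ (r ⊕ s) ≡ p ⊕ r ⊕ (q ⊕ s)
    interchange = solve-∀

  Σ∈-*ʳ : ∀ (L : List A) f c → Σ∈ L f ⊗ c ≡ Σ∈ L (λ a → f a ⊗ c)
  Σ∈-*ʳ []      f c = refl
  Σ∈-*ʳ (a ∷ L) f c = trans (ℤₚ.*-distribʳ-+ c (f a) _) (cong (f a ⊗ c ⊕_) (Σ∈-*ʳ L f c))

  Σ∈-*ˡ : ∀ (L : List A) f c → c ⊗ Σ∈ L f ≡ Σ∈ L (λ a → c ⊗ f a)
  Σ∈-*ˡ L f c = trans (ℤₚ.*-comm c _) (trans (Σ∈-*ʳ L f c) (Σ∈-cong L (λ a → ℤₚ.*-comm (f a) c)))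

  Σ∈-applyUpTo : ∀ (h : ℕ → A) n f → Σ∈ (applyUpTo h n) f ≡ Σ< n (f ∘ h)
  Σ∈-applyUpTo h zero    f = refl
  Σ∈-applyUpTo h (suc n) f = cong (f (h 0) ⊕_) (Σ∈-applyUpTo (h ∘ suc) n f)

  Σ<-Σ∈-swap : ∀ M (L : List A) (g : ℕ → A → ℤ) → Σ< M (λ b → Σ∈ L (g b)) ≡ Σ∈ L (λ a → Σ< M (λ b → g b a))
  Σ<-Σ∈-swap M []      g = Σ<-zero M (λ _ _ → refl)
  Σ<-Σ∈-swap M (a ∷ L) g = trans (Σ<-+ M (λ b → g b a) (λ b → Σ∈ L (g b))) (cong (Σ< M (λ b → g b a) ⊕_) (Σ<-Σ∈-swap M L g))

module _ {A B : Set} where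

  Σ∈-map : ∀ (h : A → B) (L : List A) f → Σ∈ (map h L) f ≡ Σ∈ L (f ∘ h)
  Σ∈-map h L f = cong (foldr _⊕_ 0ℤ) (sym (map-∘ L))

  Σ∈-concatMap : ∀ (g : A → List B) (L : List A) f → Σ∈ (concatMap g L) f ≡ Σ∈ L (λ a → Σ∈ (g a) f)
  Σ∈-concatMap g []      f = refl
  Σ∈-concatMap g (a ∷ L) f = trans (Σ∈-++ (g a) (concatMap g L) f) (cong (Σ∈ (g a) f ⊕_) (Σ∈-concatMap g L f))

Σw : ℕ → ℕ → (List ℕ → ℤ) → ℤ
Σw N k f = Σ∈ (words N k) f

Σw-zero : ∀ N f → Σw N 0 f ≡ f []
Σw-zero N f = ℤₚ.+-identityʳ (f [])

Σw-suc : ∀ N k f → Σw N (suc k) f ≡ Σ< N (λ c → Σw N k (λ κ → f (c ∷ κ)))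
Σw-suc N k f = begin
  Σ∈ (concatMap (λ c → map (c ∷_) (words N k)) (upTo N)) f ≡⟨ Σ∈-concatMap _ (upTo N) f ⟩
  Σ∈ (upTo N) (λ c → Σ∈ (map (c ∷_) (words N k)) f)      ≡⟨ Σ∈-cong (upTo N) (λ c → Σ∈-map (c ∷_) (words N k) f) ⟩
  Σ∈ (upTo N) (λ c → Σw N k (λ κ → f (c ∷ κ)))           ≡⟨ Σ∈-applyUpTo id N _ ⟩
  Σ< N (λ c → Σw N k (λ κ → f (c ∷ κ)))                  ∎

Σw-cong : ∀ N k {f g} → f ≗ g → Σw N k f ≡ Σw N k g
Σw-cong N k = Σ∈-cong (words N k)

Σw-cong-length : ∀ N k {f g} → (∀ κ → length κ ≡ k → f κ ≡ g κ) → Σw N k f ≡ Σw N k g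
Σw-cong-length N zero    {f} {g} eq = trans (Σw-zero N f) (trans (eq [] refl) (sym (Σw-zero N g)))
Σw-cong-length N (suc k) {f} {g} eq = begin
  Σw N (suc k) f
    ≡⟨ Σw-suc N k f ⟩
  Σ< N (λ c → Σw N k (λ κ → f (c ∷ κ)))
    ≡⟨ Σ<-cong N (λ c → Σw-cong-length N k (λ κ len → eq (c ∷ κ) (cong suc len))) ⟩
  Σ< N (λ c → Σw N k (λ κ → g (c ∷ κ)))
    ≡⟨ Σw-suc N k g ⟨
  Σw N (suc k) g ∎

Σw-++ : ∀ N a b f → Σw N (a + b) f ≡ Σw N a (λ u → Σw N b (λ v → f (u ++ v)))
Σw-++ N zero    b f = sym (Σw-zero N (λ u → Σw N b (λ v → f (u ++ v))))
Σw-++ N (suc a) b f = begin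
  Σw N (suc a + b) f
    ≡⟨ Σw-suc N (a + b) f ⟩
  Σ< N (λ c → Σw N (a + b) (λ κ → f (c ∷ κ)))
    ≡⟨ Σ<-cong N (λ c → Σw-++ N a b (λ κ → f (c ∷ κ))) ⟩
  Σ< N (λ c → Σw N a (λ u → Σw N b (λ v → f (c ∷ u ++ v))))
    ≡⟨ Σw-suc N a _ ⟨
  Σw N (suc a) (λ u → Σw N b (λ v → f (u ++ v))) ∎

Σw-+ : ∀ N k f g → Σw N k (λ κ → f κ ⊕ g κ) ≡ Σw N k f ⊕ Σw N k g
Σw-+ N k = Σ∈-+ (words N k)

Σw-*ˡ : ∀ N k f c → c ⊗ Σw N k f ≡ Σw N k (λ κ → c ⊗ f κ)
Σw-*ˡ N k = Σ∈-*ˡ (words N k)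

Σw-*ʳ : ∀ N k f c → Σw N k f ⊗ c ≡ Σw N k (λ κ → f κ ⊗ c)
Σw-*ʳ N k = Σ∈-*ʳ (words N k)

𝟙[_]_ : Bool → ℤ → ℤ
𝟙[ b ] t = if b then t else 0ℤ

𝟙-*ˡ : ∀ b c t → 𝟙[ b ] (c ⊗ t) ≡ c ⊗ 𝟙[ b ] t
𝟙-*ˡ false c t = sym (ℤₚ.*-zeroʳ c)
𝟙-*ˡ true  c t = refl

𝟙-* : ∀ b c s t → 𝟙[ b ] s ⊗ 𝟙[ c ] t ≡ 𝟙[ b ∧ c ] (s ⊗ t)
𝟙-* false c     s t = refl
𝟙-* true  false s t = ℤₚ.*-zeroʳ s
𝟙-* true  true  s t = refl

𝟙-not : ∀ b t → 𝟙[ not b ] t ≡ t ⊖ 𝟙[ b ] t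
𝟙-not false t = sym (ℤₚ.+-identityʳ t)
𝟙-not true  t = sym (ℤₚ.+-inverseʳ t)

𝟙-split : ∀ c b t → 𝟙[ b ] t ≡ 𝟙[ not c ∧ b ] t ⊕ 𝟙[ c ∧ b ] t
𝟙-split false false t = refl
𝟙-split false true  t = sym (ℤₚ.+-identityʳ t)
𝟙-split true  false t = refl
𝟙-split true  true  t = sym (ℤₚ.+-identityˡ t)

Σ<-𝟙-≡ᵇ : ∀ N b (g : ℕ → ℤ) → b < N → Σ< N (λ a → 𝟙[ b ≡ᵇ a ] g a) ≡ g b
Σ<-𝟙-≡ᵇ (suc N) zero    g _         = trans (cong (g 0 ⊕_) (Σ<-zero N (λ _ _ → refl))) (ℤₚ.+-identityʳ (g 0))
Σ<-𝟙-≡ᵇ (suc N) (suc b) g (s≤s b<N) = trans (ℤₚ.+-identityˡ _) (Σ<-𝟙-≡ᵇ N b (g ∘ suc) b<N)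

Σ<-𝟙-≢ᵇ : ∀ N b (g : ℕ → ℤ) → b < N → Σ< N (λ a → 𝟙[ not (b ≡ᵇ a) ] g a) ≡ Σ< N g ⊖ g b
Σ<-𝟙-≢ᵇ N b g b<N = begin
  Σ< N (λ a → 𝟙[ not (b ≡ᵇ a) ] g a)       ≡⟨ Σ<-cong N (λ a → 𝟙-not (b ≡ᵇ a) (g a)) ⟩
  Σ< N (λ a → g a ⊖ 𝟙[ b ≡ᵇ a ] g a)       ≡⟨ Σ<-⊖ N g _ ⟩
  Σ< N g ⊖ Σ< N (λ a → 𝟙[ b ≡ᵇ a ] g a)    ≡⟨ cong (Σ< N g ⊖_) (Σ<-𝟙-≡ᵇ N b g b<N) ⟩
  Σ< N g ⊖ g b                             ∎

smirnov : List ℕ → Bool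
smirnov []            = true
smirnov (a ∷ [])      = true
smirnov (a ∷ b ∷ κ)   = not (a ≡ᵇ b) ∧ smirnov (b ∷ κ)

smirnov-and : ∀ κ → and (applyUpTo (λ i → not (nth κ i ≡ᵇ nth κ (suc i))) (length κ ∸ 1)) ≡ smirnov κ
smirnov-and []          = refl
smirnov-and (a ∷ [])    = refl
smirnov-and (a ∷ b ∷ κ) = cong (not (a ≡ᵇ b) ∧_) (smirnov-and (b ∷ κ))

proper-tadpole : ∀ n l κ → length κ ≡ n →
  proper (tadpole n l) κ ≡ (not (nth κ 0 ≡ᵇ nth κ (n ∸ l ∸ 1)) ∧ smirnov κ)
proper-tadpole _ l κ refl = cong (not (nth κ 0 ≡ᵇ nth κ (length κ ∸ l ∸ 1)) ∧_)
  (trans (cong and (map-applyUpTo (λ i → (i , suc i)) _ (length κ ∸ 1))) (smirnov-and κ))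

smirnov-++ : ∀ u b s → smirnov (u ++ b ∷ s) ≡ (smirnov (u ++ b ∷ []) ∧ smirnov (b ∷ s))
smirnov-++ []           b s = refl
smirnov-++ (a ∷ [])     b s = cong (_∧ smirnov (b ∷ s)) (sym (∧-identityʳ (not (a ≡ᵇ b))))
smirnov-++ (a ∷ a′ ∷ u) b s = trans (cong (not (a ≡ᵇ a′) ∧_) (smirnov-++ (a′ ∷ u) b s))
  (sym (∧-assoc (not (a ≡ᵇ a′)) (smirnov (a′ ∷ u ++ b ∷ [])) (smirnov (b ∷ s))))

≡ᵇ-refl : ∀ b → (b ≡ᵇ b) ≡ true
≡ᵇ-refl b = dec-true (b ℕ.≟ b) refl

≡ᵇ-sym : ∀ a b → (a ≡ᵇ b) ≡ (b ≡ᵇ a)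
≡ᵇ-sym zero    zero    = refl
≡ᵇ-sym zero    (suc b) = refl
≡ᵇ-sym (suc a) zero    = refl
≡ᵇ-sym (suc a) (suc b) = ≡ᵇ-sym a b

smirnov-∷-++ : ∀ u b c → smirnov (b ∷ u ++ c ∷ []) ≡ (not (nth (u ++ c ∷ []) 0 ≡ᵇ b) ∧ smirnov (u ++ c ∷ []))
smirnov-∷-++ []      b c = cong (λ t → not t ∧ true) (≡ᵇ-sym b c)
smirnov-∷-++ (a ∷ u) b c = cong (λ t → not t ∧ smirnov (a ∷ u ++ c ∷ [])) (≡ᵇ-sym b a)

nth-++-length : ∀ u q b t → length u ≡ q → nth (u ++ b ∷ t) q ≡ b
nth-++-length []      zero    b t refl = refl
nth-++-length (a ∷ u) (suc q) b t eq   = nth-++-length u q b t (ℕₚ.suc-injective eq)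

nth-++-0 : ∀ u b t → nth (u ++ b ∷ t) 0 ≡ nth (u ++ b ∷ []) 0
nth-++-0 []      b t = refl
nth-++-0 (a ∷ u) b t = refl

Σparts : ℕ → ℕ → (List ℕ → ℤ) → ℤ
Σparts zero    zero    g = g []
Σparts zero    (suc m) g = 0ℤ
Σparts (suc k) m       g = Σ< m (λ c → Σparts k (m ∸ suc c) (λ I → g (suc c ∷ I)))

Σcomp : ℕ → (List ℕ → ℤ) → ℤ
Σcomp m g = Σ< (suc m) (λ k → Σparts k m g)

Σparts-cong : ∀ k m {g h} → (∀ I → sum I ≡ m → g I ≡ h I) → Σparts k m g ≡ Σparts k m h
Σparts-cong zero    zero    eq = eq [] refl
Σparts-cong zero    (suc m) eq = refl
Σparts-cong (suc k) m       eq = Σ<-cong-< m (λ c c<m → Σparts-cong k (m ∸ suc c)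
  (λ I ΣI≡ → eq (suc c ∷ I) (trans (cong (λ t → suc c + t) ΣI≡) (ℕₚ.m+[n∸m]≡n c<m))))

Σcomp-cong : ∀ m {g h} → (∀ I → sum I ≡ m → g I ≡ h I) → Σcomp m g ≡ Σcomp m h
Σcomp-cong m eq = Σ<-cong (suc m) (λ k → Σparts-cong k m eq)

Σparts-+ : ∀ k m g h → Σparts k m (λ I → g I ⊕ h I) ≡ Σparts k m g ⊕ Σparts k m h
Σparts-+ zero    zero    g h = refl
Σparts-+ zero    (suc m) g h = refl
Σparts-+ (suc k) m       g h = trans (Σ<-cong m (λ c → Σparts-+ k (m ∸ suc c) _ _)) (Σ<-+ m _ _)

Σcomp-+ : ∀ m g h → Σcomp m (λ I → g I ⊕ h I) ≡ Σcomp m g ⊕ Σcomp m h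
Σcomp-+ m g h = trans (Σ<-cong (suc m) (λ k → Σparts-+ k m g h)) (Σ<-+ (suc m) (λ k → Σparts k m g) (λ k → Σparts k m h))

Σparts-⊖ : ∀ k m g h → Σparts k m (λ I → g I ⊖ h I) ≡ Σparts k m g ⊖ Σparts k m h
Σparts-⊖ zero    zero    g h = refl
Σparts-⊖ zero    (suc m) g h = refl
Σparts-⊖ (suc k) m       g h = trans (Σ<-cong m (λ c → Σparts-⊖ k (m ∸ suc c) _ _)) (Σ<-⊖ m _ _)

Σcomp-⊖ : ∀ m g h → Σcomp m (λ I → g I ⊖ h I) ≡ Σcomp m g ⊖ Σcomp m h
Σcomp-⊖ m g h = trans (Σ<-cong (suc m) (λ k → Σparts-⊖ k m g h)) (Σ<-⊖ (suc m) (λ k → Σparts k m g) (λ k → Σparts k m h))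

Σparts-*ˡ : ∀ k m c g → c ⊗ Σparts k m g ≡ Σparts k m (λ I → c ⊗ g I)
Σparts-*ˡ zero    zero    c g = refl
Σparts-*ˡ zero    (suc m) c g = ℤₚ.*-zeroʳ c
Σparts-*ˡ (suc k) m       c g = trans (Σ<-*ˡ m c _) (Σ<-cong m (λ i → Σparts-*ˡ k (m ∸ suc i) c _))

Σcomp-*ˡ : ∀ m c g → c ⊗ Σcomp m g ≡ Σcomp m (λ I → c ⊗ g I)
Σcomp-*ˡ m c g = trans (Σ<-*ˡ (suc m) c (λ k → Σparts k m g)) (Σ<-cong (suc m) (λ k → Σparts-*ˡ k m c g))

Σcomp-zero : ∀ m → Σcomp m (λ _ → 0ℤ) ≡ 0ℤ
Σcomp-zero m = sym (Σcomp-*ˡ m 0ℤ (λ _ → 0ℤ))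

Σcomp-[] : ∀ g → Σcomp 0 g ≡ g []
Σcomp-[] g = ℤₚ.+-identityʳ (g [])

Σparts-too-many : ∀ k m g → m < k → Σparts k m g ≡ 0ℤ
Σparts-too-many (suc k) m g (s≤s m≤k) = Σ<-zero m (λ c c<m →
  Σparts-too-many k (m ∸ suc c) _ (ℕₚ.<-≤-trans (ℕₚ.∸-monoʳ-< (s≤s z≤n) c<m) m≤k))

Σcomp-suc : ∀ m g → Σcomp (suc m) g ≡ Σ< (suc m) (λ c → Σcomp (m ∸ c) (λ I → g (suc c ∷ I)))
Σcomp-suc m g = begin
  0ℤ ⊕ Σ< (suc m) (λ k → Σ< (suc m) (λ c → Σparts k (m ∸ c) (g′ c)))
    ≡⟨ ℤₚ.+-identityˡ _ ⟩
  Σ< (suc m) (λ k → Σ< (suc m) (λ c → Σparts k (m ∸ c) (g′ c)))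
    ≡⟨ Σ<-swap (suc m) (suc m) (λ k c → Σparts k (m ∸ c) (g′ c)) ⟩
  Σ< (suc m) (λ c → Σ< (suc m) (λ k → Σparts k (m ∸ c) (g′ c)))
    ≡⟨ Σ<-cong (suc m) (λ c →
      Σ<-vanishing-tail (suc (m ∸ c)) (suc m) _ (s≤s (ℕₚ.m∸n≤m m c)) (λ k → Σparts-too-many k (m ∸ c) (g′ c))) ⟩
  Σ< (suc m) (λ c → Σcomp (m ∸ c) (g′ c)) ∎
  where
  g′ : ℕ → List ℕ → ℤ
  g′ c I = g (suc c ∷ I)

Σcomp-cong-∷ : ∀ m {g h} → (∀ c J → g (suc c ∷ J) ≡ h (suc c ∷ J)) → Σcomp (suc m) g ≡ Σcomp (suc m) h
Σcomp-cong-∷ m {g} {h} eq = begin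
  Σcomp (suc m) g
    ≡⟨ Σcomp-suc m g ⟩
  Σ< (suc m) (λ c → Σcomp (m ∸ c) (λ J → g (suc c ∷ J)))
    ≡⟨ Σ<-cong (suc m) (λ c → Σcomp-cong (m ∸ c) (λ J _ → eq c J)) ⟩
  Σ< (suc m) (λ c → Σcomp (m ∸ c) (λ J → h (suc c ∷ J)))
    ≡⟨ Σcomp-suc m h ⟨
  Σcomp (suc m) h ∎

Σ∈-filter : ∀ {A : Set} {P : A → Set} (P? : Decidable P) (L : List A) f →
  Σ∈ (filter P? L) f ≡ Σ∈ L (λ a → 𝟙[ does (P? a) ] f a)
Σ∈-filter P? []      f = refl
Σ∈-filter P? (a ∷ L) f with does (P? a)
... | false = trans (Σ∈-filter P? L f) (sym (ℤₚ.+-identityˡ _))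
... | true  = cong (f a ⊕_) (Σ∈-filter P? L f)

does-+-≟ : ∀ a s m → a ≤ m → does (a + s ℕ.≟ m) ≡ does (s ℕ.≟ m ∸ a)
does-+-≟ a s m a≤m with s ≡ᵇ m ∸ a in eq
... | true  = dec-true (a + s ℕ.≟ m) (trans (cong (λ t → a + t) s≡m∸a) (ℕₚ.m+[n∸m]≡n a≤m))
  where
  s≡m∸a : s ≡ m ∸ a
  s≡m∸a = ℕₚ.≡ᵇ⇒≡ s (m ∸ a) (subst T (sym eq) tt)
... | false = dec-false (a + s ℕ.≟ m) (λ a+s≡m → subst T eq (ℕₚ.≡⇒≡ᵇ s (m ∸ a) (s≡m∸a a+s≡m)))
  where
  s≡m∸a : a + s ≡ m → s ≡ m ∸ a
  s≡m∸a a+s≡m = trans (sym (ℕₚ.m+n∸m≡n a s)) (cong (_∸ a) a+s≡m)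

Σw-Σparts : ∀ M k m g → m ≤ M →
  Σw M k (λ w → 𝟙[ does (sum (map suc w) ℕ.≟ m) ] g (map suc w)) ≡ Σparts k m g
Σw-Σparts M zero    zero    g _   = Σw-zero M (λ w → 𝟙[ does (sum (map suc w) ℕ.≟ 0) ] g (map suc w))
Σw-Σparts M zero    (suc m) g _   = Σw-zero M (λ w → 𝟙[ does (sum (map suc w) ℕ.≟ suc m) ] g (map suc w))
Σw-Σparts M (suc k) m       g m≤M = begin
  Σw M (suc k) (λ w → 𝟙[ does (sum (map suc w) ℕ.≟ m) ] g (map suc w))
    ≡⟨ Σw-suc M k _ ⟩
  Σ< M term
    ≡⟨ Σ<-vanishing-tail m M term m≤M term-large ⟩
  Σ< m term
    ≡⟨ Σ<-cong-< m term-small ⟩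
  Σparts (suc k) m g ∎
  where
  term : ℕ → ℤ
  term c = Σw M k (λ w → 𝟙[ does (suc c + sum (map suc w) ℕ.≟ m) ] g (suc c ∷ map suc w))
  term-large : ∀ c → m ≤ c → term c ≡ 0ℤ
  term-large c m≤c = trans (Σw-cong M k (λ w → cong (𝟙[_] g (suc c ∷ map suc w))
                          (dec-false (_ ℕ.≟ m) (λ e → ℕₚ.<⇒≱ (subst (suc c ≤_) e (ℕₚ.m≤m+n (suc c) _)) m≤c))))
                        (Σ∈-zero (words M k))
  term-small : ∀ c → c < m → term c ≡ Σparts k (m ∸ suc c) (λ I → g (suc c ∷ I))
  term-small c c<m = trans (Σw-cong M k (λ w → cong (𝟙[_] g (suc c ∷ map suc w)) (does-+-≟ (suc c) _ m c<m)))
                        (Σw-Σparts M k (m ∸ suc c) _ (ℕₚ.≤-trans (ℕₚ.m∸n≤m m (suc c)) m≤M))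

Σ∈-compositions : ∀ n g → Σ∈ (compositions n) g ≡ Σcomp n g
Σ∈-compositions n g = begin
  Σ∈ (filter (λ I → sum I ℕ.≟ n) (concatMap (positiveWords n) (upTo (suc n)))) g
    ≡⟨ Σ∈-filter (λ I → sum I ℕ.≟ n) (concatMap (positiveWords n) (upTo (suc n))) g ⟩
  Σ∈ (concatMap (positiveWords n) (upTo (suc n))) G
    ≡⟨ Σ∈-concatMap (positiveWords n) (upTo (suc n)) G ⟩
  Σ∈ (upTo (suc n)) (λ k → Σ∈ (positiveWords n k) G)
    ≡⟨ Σ∈-applyUpTo id (suc n) (λ k → Σ∈ (positiveWords n k) G) ⟩
  Σ< (suc n) (λ k → Σ∈ (map (map suc) (words n k)) G)
    ≡⟨ Σ<-cong (suc n) (λ k → trans (Σ∈-map (map suc) (words n k) G) (Σw-Σparts n k n g ℕₚ.≤-refl)) ⟩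
  Σcomp n g ∎
  where
  G : List ℕ → ℤ
  G I = 𝟙[ does (sum I ℕ.≟ n) ] g I

≤ᵇ-true : ∀ {m n} → m ≤ n → (m ≤ᵇ n) ≡ true
≤ᵇ-true {m} {n} = dec-true (m ℕ.≤? n)

≤ᵇ-false : ∀ {m n} → n < m → (m ≤ᵇ n) ≡ false
≤ᵇ-false {m} {n} n<m = dec-false (m ℕ.≤? n) (ℕₚ.<⇒≱ n<m)

≤ᵇ-+ : ∀ b k t → (b ≤ᵇ k + t) ≡ (b ∸ k ≤ᵇ t)
≤ᵇ-+ b       zero    t = refl
≤ᵇ-+ zero    (suc k) t = refl
≤ᵇ-+ (suc b) (suc k) t = trans (suc-≤ᵇ-suc b (k + t)) (≤ᵇ-+ b k t)
  where
  suc-≤ᵇ-suc : ∀ b n → (suc b ≤ᵇ suc n) ≡ (b ≤ᵇ n)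
  suc-≤ᵇ-suc zero    n = refl
  suc-≤ᵇ-suc (suc b) n = refl

filter-≤?-map-+ : ∀ b k L →
  filter (λ s → b ℕ.≤? s) (map (λ t → k + t) L) ≡ map (λ t → k + t) (filter (λ s → b ∸ k ℕ.≤? s) L)
filter-≤?-map-+ b k []      = refl
filter-≤?-map-+ b k (t ∷ L) with b ≤ᵇ k + t | b ∸ k ≤ᵇ t | ≤ᵇ-+ b k t
... | true  | true  | refl = cong (k + t ∷_) (filter-≤?-map-+ b k L)
... | false | false | refl = filter-≤?-map-+ b k L

foldr-⊓-map-+ : ∀ k s L → foldr _⊓_ (k + s) (map (λ t → k + t) L) ≡ k + foldr _⊓_ s L
foldr-⊓-map-+ k s []      = refl
foldr-⊓-map-+ k s (t ∷ L) = trans (cong ((k + t) ⊓_) (foldr-⊓-map-+ k s L)) (sym (ℕₚ.+-distribˡ-⊓ k t _))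

σ⁺-∷ : ∀ k J a → σ⁺ (k ∷ J) (suc a) ≡ k + σ⁺ J (suc a ∸ k)
σ⁺-∷ k J a = trans (cong (foldr _⊓_ (k + sum J)) (filter-≤?-map-+ (suc a) k (prefixSums J)))
                   (foldr-⊓-map-+ k (sum J) (filter (λ s → suc a ∸ k ℕ.≤? s) (prefixSums J)))

σ⁺-0 : ∀ J → σ⁺ J 0 ≡ 0
σ⁺-0 []      = refl
σ⁺-0 (i ∷ J) = refl

-- Agrees with Θ⁺ I a for a ≥ 1 only (Θ⁺ I 0 = 0, whereas Θrec (k ∷ J) 0 = k).
Θrec : List ℕ → ℕ → ℕ
Θrec []      a = 0
Θrec (k ∷ J) a = if a ≤ᵇ k then k ∸ a else Θrec J (a ∸ k)

Θrec-∷-≤ : ∀ {a k} J → a ≤ k → Θrec (k ∷ J) a ≡ k ∸ a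
Θrec-∷-≤ J a≤k rewrite ≤ᵇ-true a≤k = refl

Θrec-∷-> : ∀ {a k} J → k < a → Θrec (k ∷ J) a ≡ Θrec J (a ∸ k)
Θrec-∷-> J k<a rewrite ≤ᵇ-false k<a = refl

Θ⁺≡Θrec : ∀ I a → Θ⁺ I (suc a) ≡ Θrec I (suc a)
Θ⁺≡Θrec []      a = refl
Θ⁺≡Θrec (k ∷ J) a with suc a ℕ.≤? k
... | yes a<k = begin
  σ⁺ (k ∷ J) (suc a) ∸ suc a       ≡⟨ cong (_∸ suc a) (σ⁺-∷ k J a) ⟩
  k + σ⁺ J (suc a ∸ k) ∸ suc a     ≡⟨ cong (λ t → k + σ⁺ J t ∸ suc a) (ℕₚ.m≤n⇒m∸n≡0 a<k) ⟩
  k + σ⁺ J 0 ∸ suc a               ≡⟨ cong (λ t → k + t ∸ suc a) (σ⁺-0 J) ⟩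
  k + 0 ∸ suc a                    ≡⟨ cong (_∸ suc a) (ℕₚ.+-identityʳ k) ⟩
  k ∸ suc a                        ≡⟨ Θrec-∷-≤ J a<k ⟨
  Θrec (k ∷ J) (suc a)             ∎
... | no a≮k = begin
  σ⁺ (k ∷ J) (suc a) ∸ suc a
    ≡⟨ cong (_∸ suc a) (σ⁺-∷ k J a) ⟩
  k + σ⁺ J (suc a ∸ k) ∸ suc a
    ≡⟨ cong (k + σ⁺ J (suc a ∸ k) ∸_) (sym (ℕₚ.m+[n∸m]≡n (ℕₚ.<⇒≤ k<1+a))) ⟩
  k + σ⁺ J (suc a ∸ k) ∸ (k + (suc a ∸ k))
    ≡⟨ ℕₚ.[m+n]∸[m+o]≡n∸o k _ _ ⟩
  σ⁺ J (suc a ∸ k) ∸ (suc a ∸ k)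
    ≡⟨ cong (λ t → σ⁺ J t ∸ t) 1+a∸k ⟩
  Θ⁺ J (suc (a ∸ k))
    ≡⟨ Θ⁺≡Θrec J (a ∸ k) ⟩
  Θrec J (suc (a ∸ k))
    ≡⟨ cong (Θrec J) 1+a∸k ⟨
  Θrec J (suc a ∸ k)
    ≡⟨ Θrec-∷-> J k<1+a ⟨
  Θrec (k ∷ J) (suc a) ∎
  where
  k<1+a : k < suc a
  k<1+a = ℕₚ.≰⇒> a≮k
  1+a∸k : suc a ∸ k ≡ suc (a ∸ k)
  1+a∸k = ℕₚ.+-∸-assoc 1 (ℕₚ.≤-pred k<1+a)

Θrec-sum : ∀ I → Θrec I (sum I) ≡ 0
Θrec-sum []      = refl
Θrec-sum (k ∷ J) with k + sum J ≤ᵇ k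
... | true  = ℕₚ.m≤n⇒m∸n≡0 (ℕₚ.m≤m+n k (sum J))
... | false = trans (cong (Θrec J) (ℕₚ.m+n∸m≡n k (sum J))) (Θrec-sum J)

-- Vanishes unless a is a partial sum of I.
V : List ℕ → ℕ → ℤ
V I a = + Θrec I (suc a) ⊖ + Θrec I a ⊕ 1ℤ

V-∷-inside : ∀ k J a → suc a < k → V (k ∷ J) (suc a) ≡ 0ℤ
V-∷-inside k J a a+1<k = begin
  + Θrec (k ∷ J) (suc (suc a)) ⊖ + Θrec (k ∷ J) (suc a) ⊕ 1ℤ
    ≡⟨ cong₂ (λ s t → + s ⊖ + t ⊕ 1ℤ) (Θrec-∷-≤ J a+1<k) (Θrec-∷-≤ J (ℕₚ.<⇒≤ a+1<k)) ⟩
  + (k ∸ suc (suc a)) ⊖ + (k ∸ suc a) ⊕ 1ℤ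
    ≡⟨ cong (λ t → + (k ∸ suc (suc a)) ⊖ t ⊕ 1ℤ) (trans (cong +_ (ℕₚ.+-∸-assoc 1 a+1<k)) (ℤₚ.pos-+ 1 _)) ⟩
  + (k ∸ suc (suc a)) ⊖ (1ℤ ⊕ + (k ∸ suc (suc a))) ⊕ 1ℤ
    ≡⟨ cancel (+ (k ∸ suc (suc a))) ⟩
  0ℤ ∎
  where
  cancel : ∀ t → t ⊖ (1ℤ ⊕ t) ⊕ 1ℤ ≡ 0ℤ
  cancel = solve-∀

V-∷-end : ∀ J a → V (suc a ∷ J) (suc a) ≡ + Θrec J 1 ⊕ 1ℤ
V-∷-end J a = begin
  + Θrec (suc a ∷ J) (suc (suc a)) ⊖ + Θrec (suc a ∷ J) (suc a) ⊕ 1ℤ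
    ≡⟨ cong₂ (λ s t → + s ⊖ + t ⊕ 1ℤ) (Θrec-∷-> J (ℕₚ.n<1+n (suc a))) (Θrec-∷-≤ J (ℕₚ.≤-refl {suc a})) ⟩
  + Θrec J (suc a ∸ a) ⊖ + (a ∸ a) ⊕ 1ℤ
    ≡⟨ cong₂ (λ s t → + Θrec J s ⊖ + t ⊕ 1ℤ) (trans (ℕₚ.+-∸-assoc 1 (ℕₚ.≤-refl {a})) (cong suc (ℕₚ.n∸n≡0 a))) (ℕₚ.n∸n≡0 a) ⟩
  + Θrec J 1 ⊖ 0ℤ ⊕ 1ℤ
    ≡⟨ cong (_⊕ 1ℤ) (ℤₚ.+-identityʳ (+ Θrec J 1)) ⟩
  + Θrec J 1 ⊕ 1ℤ ∎

V-∷-before : ∀ k J a → k ≤ a → V (k ∷ J) (suc a) ≡ V J (suc a ∸ k)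
V-∷-before k J a k≤a = begin
  + Θrec (k ∷ J) (suc (suc a)) ⊖ + Θrec (k ∷ J) (suc a) ⊕ 1ℤ
    ≡⟨ cong₂ (λ s t → + s ⊖ + t ⊕ 1ℤ) (Θrec-∷-> J (s≤s (ℕₚ.m≤n⇒m≤1+n k≤a))) (Θrec-∷-> J (s≤s k≤a)) ⟩
  + Θrec J (suc (suc a) ∸ k) ⊖ + Θrec J (suc a ∸ k) ⊕ 1ℤ
    ≡⟨ cong (λ s → + Θrec J s ⊖ + Θrec J (suc a ∸ k) ⊕ 1ℤ) (ℕₚ.+-∸-assoc 1 (ℕₚ.m≤n⇒m≤1+n k≤a)) ⟩
  V J (suc a ∸ k) ∎

module _ (N : ℕ) (x : ℕ → ℤ) where

  xs : List ℤ
  xs = map x (upTo N)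

  π : Series
  π = signedPowerSums xs

  π-Σ : ∀ j → π j ≡ Σ< N (λ b → alternating (x b) j)
  π-Σ j = trans (cong (λ ys → signedPowerSums ys j) (map-applyUpTo id x N)) (signedPowerSums-applyUpTo x N j)

  π-0 : π 0 ≡ 0ℤ
  π-0 = trans (π-Σ 0) (Σ<-zero N (λ _ _ → refl))

  monomial : List ℕ → ℤ
  monomial κ = foldr _⊗_ 1ℤ (map x κ)

  path-term : List ℕ → ℤ
  path-term κ = 𝟙[ smirnov κ ] monomial κ

  XP : Series
  XP m = Σw N m path-term

  XP-after : ℕ → ℕ → ℤ
  XP-after b m = Σw N m (λ κ → 𝟙[ smirnov (b ∷ κ) ] monomial κ)

  XP-suc : ∀ m → XP (suc m) ≡ Σ< N (λ b → x b ⊗ XP-after b m)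
  XP-suc m = trans (Σw-suc N m _) (Σ<-cong N (λ b → trans
    (Σw-cong N m (λ κ → 𝟙-*ˡ (smirnov (b ∷ κ)) (x b) (monomial κ)))
    (sym (Σw-*ˡ N m _ (x b)))))

  XP-after-suc : ∀ m b → b < N → XP-after b (suc m) ≡ XP (suc m) ⊖ x b ⊗ XP-after b m
  XP-after-suc m b b<N = begin
    XP-after b (suc m)
      ≡⟨ Σw-suc N m _ ⟩
    Σ< N (λ a → Σw N m (λ κ → 𝟙[ not (b ≡ᵇ a) ∧ smirnov (a ∷ κ) ] (x a ⊗ monomial κ)))
      ≡⟨ Σ<-cong N (λ a → factor (not (b ≡ᵇ a)) a) ⟩
    Σ< N (λ a → 𝟙[ not (b ≡ᵇ a) ] (x a ⊗ XP-after a m))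
      ≡⟨ Σ<-𝟙-≢ᵇ N b (λ a → x a ⊗ XP-after a m) b<N ⟩
    Σ< N (λ a → x a ⊗ XP-after a m) ⊖ x b ⊗ XP-after b m
      ≡⟨ cong (_⊖ x b ⊗ XP-after b m) (XP-suc m) ⟨
    XP (suc m) ⊖ x b ⊗ XP-after b m ∎
    where
    factor : ∀ c a → Σw N m (λ κ → 𝟙[ c ∧ smirnov (a ∷ κ) ] (x a ⊗ monomial κ)) ≡ 𝟙[ c ] (x a ⊗ XP-after a m)
    factor false a = Σ∈-zero (words N m)
    factor true  a = trans (Σw-cong N m (λ κ → 𝟙-*ˡ (smirnov (a ∷ κ)) (x a) (monomial κ))) (sym (Σw-*ˡ N m _ (x a)))

  Σ-alternating-after : ∀ m j →
    Σ< N (λ b → alternating (x b) (suc j) ⊗ XP-after b m) ≡ Σ< (suc m) (λ i → π (suc (j + i)) ⊗ XP (m ∸ i))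
  Σ-alternating-after zero j = begin
    Σ< N (λ b → alternating (x b) (suc j) ⊗ 1ℤ)  ≡⟨ Σ<-cong N (λ b → ℤₚ.*-identityʳ _) ⟩
    Σ< N (λ b → alternating (x b) (suc j))       ≡⟨ π-Σ (suc j) ⟨
    π (suc j)                                    ≡⟨ lift (π (suc j)) ⟩
    π (suc j) ⊗ 1ℤ ⊕ 0ℤ                          ≡⟨ cong (λ t → π (suc t) ⊗ 1ℤ ⊕ 0ℤ) (ℕₚ.+-identityʳ j) ⟨
    π (suc (j + 0)) ⊗ 1ℤ ⊕ 0ℤ                    ∎
    where
    lift : ∀ a → a ≡ a ⊗ 1ℤ ⊕ 0ℤ
    lift = solve-∀
  Σ-alternating-after (suc m) j = begin
    Σ< N (λ b → α b (suc j) ⊗ XP-after b (suc m))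
      ≡⟨ Σ<-cong-< N (λ b b<N → trans (cong (α b (suc j) ⊗_) (XP-after-suc m b b<N)) (expand ((⊝ x b) ^ j) (x b) _ _)) ⟩
    Σ< N (λ b → α b (suc j) ⊗ XP (suc m) ⊕ α b (suc (suc j)) ⊗ XP-after b m)
      ≡⟨ Σ<-+ N _ _ ⟩
    Σ< N (λ b → α b (suc j) ⊗ XP (suc m)) ⊕ Σ< N (λ b → α b (suc (suc j)) ⊗ XP-after b m)
      ≡⟨ cong₂ _⊕_ (trans (sym (Σ<-*ʳ N (XP (suc m)) (λ b → α b (suc j)))) (cong (_⊗ XP (suc m)) (sym (π-Σ (suc j)))))
                   (Σ-alternating-after m (suc j)) ⟩
    π (suc j) ⊗ XP (suc m) ⊕ Σ< (suc m) (λ i → π (suc (suc j + i)) ⊗ XP (m ∸ i))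
      ≡⟨ cong₂ _⊕_ (cong (λ t → π (suc t) ⊗ XP (suc m)) (sym (ℕₚ.+-identityʳ j)))
                   (Σ<-cong (suc m) (λ i → cong (λ t → π (suc t) ⊗ XP (m ∸ i)) (sym (ℕₚ.+-suc j i)))) ⟩
    Σ< (suc (suc m)) (λ i → π (suc (j + i)) ⊗ XP (suc m ∸ i)) ∎
    where
    α : ℕ → ℕ → ℤ
    α b = alternating (x b)
    expand : ∀ p y P q → p ⊗ y ⊗ (P ⊖ y ⊗ q) ≡ p ⊗ y ⊗ P ⊕ ⊝ y ⊗ p ⊗ y ⊗ q
    expand = solve-∀

  XP-recurrence : XP ≗ 𝟏 +ₛ π ⋆ XP
  XP-recurrence zero    = cong (1ℤ ⊕_) (sym (trans (ℤₚ.+-identityʳ _) (cong (_⊗ 1ℤ) π-0)))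
  XP-recurrence (suc m) = begin
    XP (suc m)
      ≡⟨ XP-suc m ⟩
    Σ< N (λ b → x b ⊗ XP-after b m)
      ≡⟨ Σ<-cong N (λ b → cong (_⊗ XP-after b m) (sym (ℤₚ.*-identityˡ (x b)))) ⟩
    Σ< N (λ b → alternating (x b) 1 ⊗ XP-after b m)
      ≡⟨ Σ-alternating-after m 0 ⟩
    Σ< (suc m) (λ i → π (suc i) ⊗ XP (m ∸ i))
      ≡⟨ ⋆-suc π XP m π-0 ⟨
    (π ⋆ XP) (suc m)
      ≡⟨ ℤₚ.+-identityˡ _ ⟨
    (𝟏 +ₛ π ⋆ XP) (suc m) ∎

  E : Series
  E = esym xs

  e[_] : List ℕ → ℤ
  e[ I ] = eI I N x

  Π⁻ : List ℕ → ℕ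
  Π⁻ I = product (map (λ j → j ∸ 1) I)

  wSum ΠSum : Series
  wSum m = Σcomp m (λ I → + w I ⊗ e[ I ])
  ΠSum m = Σcomp m (λ I → + Π⁻ I ⊗ e[ I ])

  Σcomp-first-part : ∀ m (φ : ℕ → ℕ) (G : List ℕ → ℤ) →
    (∀ c J → G (suc c ∷ J) ≡ + (φ (suc c) * Π⁻ J) ⊗ (E (suc c) ⊗ e[ J ])) →
    Σcomp (suc m) G ≡ Σ< (suc m) (λ c → + φ (suc c) ⊗ E (suc c) ⊗ ΠSum (m ∸ c))
  Σcomp-first-part m φ G G-∷ = trans (Σcomp-suc m G) (Σ<-cong (suc m) (λ c → begin
    Σcomp (m ∸ c) (λ J → G (suc c ∷ J))
      ≡⟨ Σcomp-cong (m ∸ c) (λ J _ → trans (G-∷ c J) (trans (cong (_⊗ (E (suc c) ⊗ e[ J ])) (ℤₚ.pos-* (φ (suc c)) (Π⁻ J)))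
                                                               (regroup (+ φ (suc c)) (+ Π⁻ J) (E (suc c)) e[ J ]))) ⟩
    Σcomp (m ∸ c) (λ J → + φ (suc c) ⊗ E (suc c) ⊗ (+ Π⁻ J ⊗ e[ J ]))
      ≡⟨ Σcomp-*ˡ (m ∸ c) (+ φ (suc c) ⊗ E (suc c)) (λ J → + Π⁻ J ⊗ e[ J ]) ⟨
    + φ (suc c) ⊗ E (suc c) ⊗ ΠSum (m ∸ c) ∎))
    where
    regroup : ∀ a b c d → a ⊗ b ⊗ (c ⊗ d) ≡ a ⊗ c ⊗ (b ⊗ d)
    regroup = solve-∀

  wSum-recurrence : wSum ≗ 𝟏 +ₛ z∂ E ⋆ ΠSum
  wSum-recurrence zero    = Σcomp-[] (λ I → + w I ⊗ e[ I ])
  wSum-recurrence (suc m) = begin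
    wSum (suc m)
      ≡⟨ Σcomp-first-part m id (λ I → + w I ⊗ e[ I ]) (λ c J → refl) ⟩
    Σ< (suc m) (λ c → z∂ E (suc c) ⊗ ΠSum (m ∸ c))
      ≡⟨ ⋆-suc (z∂ E) ΠSum m refl ⟨
    (z∂ E ⋆ ΠSum) (suc m)
      ≡⟨ ℤₚ.+-identityˡ _ ⟨
    (𝟏 +ₛ z∂ E ⋆ ΠSum) (suc m) ∎

  u : Series
  u n = + (n ∸ 1) ⊗ E n

  ΠSum-recurrence : ΠSum ≗ 𝟏 +ₛ u ⋆ ΠSum
  ΠSum-recurrence zero    = Σcomp-[] (λ I → + Π⁻ I ⊗ e[ I ])
  ΠSum-recurrence (suc m) = begin
    ΠSum (suc m)
      ≡⟨ Σcomp-first-part m (λ k → k ∸ 1) (λ I → + Π⁻ I ⊗ e[ I ]) (λ c J → refl) ⟩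
    Σ< (suc m) (λ c → u (suc c) ⊗ ΠSum (m ∸ c))
      ≡⟨ ⋆-suc u ΠSum m refl ⟨
    (u ⋆ ΠSum) (suc m)
      ≡⟨ ℤₚ.+-identityˡ _ ⟨
    (𝟏 +ₛ u ⋆ ΠSum) (suc m) ∎

  E-z∂E : E -ₛ z∂ E ≗ 𝟏 -ₛ u
  E-z∂E zero    = cong (_⊖ z∂ E 0) (esym-0 xs)
  E-z∂E (suc k) = trans (cong (λ t → E (suc k) ⊖ t ⊗ E (suc k)) (ℤₚ.pos-+ 1 k)) (rearrange (E (suc k)) (+ k))
    where
    rearrange : ∀ a b → a ⊖ (1ℤ ⊕ b) ⊗ a ≡ 0ℤ ⊖ b ⊗ a
    rearrange = solve-∀

  ΠSum⋆[E-z∂E] : ΠSum ⋆ (E -ₛ z∂ E) ≗ 𝟏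
  ΠSum⋆[E-z∂E] n = begin
    (ΠSum ⋆ (E -ₛ z∂ E)) n                 ≡⟨ ⋆-congˡ ΠSum E-z∂E n ⟩
    (ΠSum ⋆ (𝟏 -ₛ u)) n                    ≡⟨ ⋆-distribˡ-⊖ ΠSum 𝟏 u n ⟩
    (ΠSum ⋆ 𝟏) n ⊖ (ΠSum ⋆ u) n            ≡⟨ cong₂ _⊖_ (⋆-identityʳ ΠSum n) (⋆-comm ΠSum u n) ⟩
    ΠSum n ⊖ (u ⋆ ΠSum) n                  ≡⟨ cong (_⊖ (u ⋆ ΠSum) n) (ΠSum-recurrence n) ⟩
    𝟏 n ⊕ (u ⋆ ΠSum) n ⊖ (u ⋆ ΠSum) n      ≡⟨ cancel (𝟏 n) _ ⟩
    𝟏 n                                    ∎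
    where
    cancel : ∀ a b → a ⊕ b ⊖ b ≡ a
    cancel = solve-∀

  wSum⋆[E-z∂E] : wSum ⋆ (E -ₛ z∂ E) ≗ E
  wSum⋆[E-z∂E] n = begin
    (wSum ⋆ (E -ₛ z∂ E)) n
      ≡⟨ ⋆-congʳ (E -ₛ z∂ E) wSum-recurrence n ⟩
    ((𝟏 +ₛ z∂ E ⋆ ΠSum) ⋆ (E -ₛ z∂ E)) n
      ≡⟨ ⋆-distribʳ-+ 𝟏 (z∂ E ⋆ ΠSum) (E -ₛ z∂ E) n ⟩
    (𝟏 ⋆ (E -ₛ z∂ E)) n ⊕ (z∂ E ⋆ ΠSum ⋆ (E -ₛ z∂ E)) n
      ≡⟨ cong₂ _⊕_ (⋆-identityˡ (E -ₛ z∂ E) n) (⋆-assoc (z∂ E) ΠSum (E -ₛ z∂ E) n) ⟩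
    E n ⊖ z∂ E n ⊕ (z∂ E ⋆ (ΠSum ⋆ (E -ₛ z∂ E))) n
      ≡⟨ cong (E n ⊖ z∂ E n ⊕_) (trans (⋆-congˡ (z∂ E) ΠSum⋆[E-z∂E] n) (⋆-identityʳ (z∂ E) n)) ⟩
    E n ⊖ z∂ E n ⊕ z∂ E n
      ≡⟨ cancel (E n) (z∂ E n) ⟩
    E n ∎
    where
    cancel : ∀ a b → a ⊖ b ⊕ b ≡ a
    cancel = solve-∀

  XP⋆[E-z∂E] : XP ⋆ (E -ₛ z∂ E) ≗ E
  XP⋆[E-z∂E] n = begin
    (XP ⋆ (E -ₛ z∂ E)) n
      ≡⟨ ⋆-distribˡ-⊖ XP E (z∂ E) n ⟩
    (XP ⋆ E) n ⊖ (XP ⋆ z∂ E) n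
      ≡⟨ cong ((XP ⋆ E) n ⊖_) (trans (⋆-congˡ XP (newton xs) n) (sym (⋆-assoc XP π E n))) ⟩
    (XP ⋆ E) n ⊖ (XP ⋆ π ⋆ E) n
      ≡⟨ ⋆-distribʳ-⊖ XP (XP ⋆ π) E n ⟨
    ((XP -ₛ XP ⋆ π) ⋆ E) n
      ≡⟨ ⋆-congʳ E XP-XP⋆π n ⟩
    (𝟏 ⋆ E) n
      ≡⟨ ⋆-identityˡ E n ⟩
    E n ∎
    where
    cancel : ∀ a b → a ⊕ b ⊖ b ≡ a
    cancel = solve-∀
    XP-XP⋆π : XP -ₛ XP ⋆ π ≗ 𝟏
    XP-XP⋆π n = trans (cong₂ _⊖_ (XP-recurrence n) (⋆-comm XP π n)) (cancel (𝟏 n) _)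

  -- Both sides equal E / (E - z E′), a legitimate quotient since E - z E′ has constant term 1.
  XP≗wSum : XP ≗ wSum
  XP≗wSum = ⋆-cancelʳ (E -ₛ z∂ E) (cong (_⊖ z∂ E 0) (esym-0 xs)) (λ n → trans (XP⋆[E-z∂E] n) (sym (wSum⋆[E-z∂E] n)))

  -- The recurrence on the composition side

  weight : (ℕ → ℕ) → List ℕ → ℕ
  weight φ []      = 1
  weight φ (k ∷ J) = φ k * Π⁻ J

  w≡weight-id : ∀ I → w I ≡ weight id I
  w≡weight-id []      = refl
  w≡weight-id (i ∷ I) = refl

  Π⁻≡weight-pred : ∀ I → Π⁻ I ≡ weight (λ k → k ∸ 1) I
  Π⁻≡weight-pred []      = refl
  Π⁻≡weight-pred (i ∷ I) = refl

  ΘwSum : ℕ → ℕ → ℤ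
  ΘwSum n b = Σcomp n (λ I → + (Θrec I b * w I) ⊗ e[ I ])

  cycleSum : Series
  cycleSum m = ΘwSum m 1

  cycleSum-Π⁻ : ∀ m → Σcomp (suc m) (λ J → (+ Θrec J 1 ⊕ 1ℤ) ⊗ (+ Π⁻ J ⊗ e[ J ])) ≡ cycleSum (suc m)
  cycleSum-Π⁻ m = Σcomp-cong-∷ m {λ J → (+ Θrec J 1 ⊕ 1ℤ) ⊗ (+ Π⁻ J ⊗ e[ J ])} {λ J → + (Θrec J 1 * w J) ⊗ e[ J ]} first-part
    where
    first-part : ∀ j J → (+ j ⊕ 1ℤ) ⊗ (+ (j * Π⁻ J) ⊗ e[ suc j ∷ J ]) ≡ + (j * (suc j * Π⁻ J)) ⊗ e[ suc j ∷ J ]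
    first-part j J = begin
      (+ j ⊕ 1ℤ) ⊗ (+ (j * Π⁻ J) ⊗ e)                  ≡⟨ cong (λ t → (+ j ⊕ 1ℤ) ⊗ (t ⊗ e)) (ℤₚ.pos-* j (Π⁻ J)) ⟩
      (+ j ⊕ 1ℤ) ⊗ (+ j ⊗ + Π⁻ J ⊗ e)                  ≡⟨ regroup (+ j) (+ Π⁻ J) e ⟩
      + j ⊗ ((1ℤ ⊕ + j) ⊗ + Π⁻ J) ⊗ e                  ≡⟨ cong (λ t → + j ⊗ (t ⊗ + Π⁻ J) ⊗ e) (ℤₚ.pos-+ 1 j) ⟨
      + j ⊗ (+ suc j ⊗ + Π⁻ J) ⊗ e                     ≡⟨ cong (λ t → + j ⊗ t ⊗ e) (ℤₚ.pos-* (suc j) (Π⁻ J)) ⟨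
      + j ⊗ + (suc j * Π⁻ J) ⊗ e                       ≡⟨ cong (_⊗ e) (ℤₚ.pos-* j (suc j * Π⁻ J)) ⟨
      + (j * (suc j * Π⁻ J)) ⊗ e                       ∎
      where
      e : ℤ
      e = e[ suc j ∷ J ]
      regroup : ∀ a b c → (a ⊕ 1ℤ) ⊗ (a ⊗ b ⊗ c) ≡ a ⊗ ((1ℤ ⊕ a) ⊗ b) ⊗ c
      regroup = solve-∀

  Σcomp-V-∷ : ∀ k c a φ →
    Σcomp k (λ J → V (suc c ∷ J) a ⊗ (+ weight φ (suc c ∷ J) ⊗ e[ suc c ∷ J ]))
    ≡ + φ (suc c) ⊗ E (suc c) ⊗ Σcomp k (λ J → V (suc c ∷ J) a ⊗ (+ Π⁻ J ⊗ e[ J ]))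
  Σcomp-V-∷ k c a φ = trans (Σcomp-cong k (λ J _ → factor J))
                            (sym (Σcomp-*ˡ k (+ φ (suc c) ⊗ E (suc c)) (λ J → V (suc c ∷ J) a ⊗ (+ Π⁻ J ⊗ e[ J ]))))
    where
    regroup : ∀ v p q r s → v ⊗ (p ⊗ q ⊗ (r ⊗ s)) ≡ p ⊗ r ⊗ (v ⊗ (q ⊗ s))
    regroup = solve-∀
    factor : ∀ J → V (suc c ∷ J) a ⊗ (+ (φ (suc c) * Π⁻ J) ⊗ (E (suc c) ⊗ e[ J ]))
                   ≡ + φ (suc c) ⊗ E (suc c) ⊗ (V (suc c ∷ J) a ⊗ (+ Π⁻ J ⊗ e[ J ]))
    factor J = trans (cong (λ t → V (suc c ∷ J) a ⊗ (t ⊗ (E (suc c) ⊗ e[ J ]))) (ℤₚ.pos-* (φ (suc c)) (Π⁻ J)))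
                     (regroup (V (suc c ∷ J) a) (+ φ (suc c)) (+ Π⁻ J) (E (suc c)) e[ J ])

  Σcomp-V-∷-inside : ∀ k c a → a < c → Σcomp k (λ J → V (suc c ∷ J) (suc a) ⊗ (+ Π⁻ J ⊗ e[ J ])) ≡ 0ℤ
  Σcomp-V-∷-inside k c a a<c =
    trans (Σcomp-cong k (λ J _ → cong (_⊗ (+ Π⁻ J ⊗ e[ J ])) (V-∷-inside (suc c) J a (s≤s a<c)))) (Σcomp-zero k)

  Σcomp-V-∷-end : ∀ m a → a < m → Σcomp (m ∸ a) (λ J → V (suc a ∷ J) (suc a) ⊗ (+ Π⁻ J ⊗ e[ J ])) ≡ cycleSum (m ∸ a)
  Σcomp-V-∷-end m a a<m = begin
    Σcomp (m ∸ a) (λ J → V (suc a ∷ J) (suc a) ⊗ (+ Π⁻ J ⊗ e[ J ]))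
      ≡⟨ Σcomp-cong (m ∸ a) (λ J _ → cong (_⊗ (+ Π⁻ J ⊗ e[ J ])) (V-∷-end J a)) ⟩
    Σcomp (m ∸ a) (λ J → (+ Θrec J 1 ⊕ 1ℤ) ⊗ (+ Π⁻ J ⊗ e[ J ]))
      ≡⟨ cong (λ k → Σcomp k (λ J → (+ Θrec J 1 ⊕ 1ℤ) ⊗ (+ Π⁻ J ⊗ e[ J ]))) m∸a≡1+ ⟩
    Σcomp (suc (m ∸ suc a)) (λ J → (+ Θrec J 1 ⊕ 1ℤ) ⊗ (+ Π⁻ J ⊗ e[ J ]))
      ≡⟨ cycleSum-Π⁻ (m ∸ suc a) ⟩
    cycleSum (suc (m ∸ suc a))
      ≡⟨ cong cycleSum m∸a≡1+ ⟨
    cycleSum (m ∸ a) ∎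
    where
    m∸a≡1+ : m ∸ a ≡ suc (m ∸ suc a)
    m∸a≡1+ = ℕₚ.+-∸-assoc 1 a<m

  Σcomp-V-∷-before : ∀ k c a → c < a →
    Σcomp k (λ J → V (suc c ∷ J) (suc a) ⊗ (+ Π⁻ J ⊗ e[ J ])) ≡ Σcomp k (λ J → V J (a ∸ c) ⊗ (+ weight (λ i → i ∸ 1) J ⊗ e[ J ]))
  Σcomp-V-∷-before k c a c<a = Σcomp-cong k (λ J _ →
    cong₂ (λ v p → v ⊗ (+ p ⊗ e[ J ])) (V-∷-before (suc c) J a c<a) (Π⁻≡weight-pred J))

  -- V I a picks out the compositions I having a as a partial sum and cuts them there;
  -- the part after the cut carries the weight of a cycle.
  Σcomp-V : ∀ a m φ → 1 ≤ a → a < m →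
    Σcomp m (λ I → V I a ⊗ (+ weight φ I ⊗ e[ I ])) ≡ Σcomp a (λ J → + weight φ J ⊗ e[ J ]) ⊗ cycleSum (m ∸ a)
  Σcomp-V = <-rec _ cut
    where
    Cut : ℕ → Set
    Cut a = ∀ m φ → 1 ≤ a → a < m →
      Σcomp m (λ I → V I a ⊗ (+ weight φ I ⊗ e[ I ])) ≡ Σcomp a (λ J → + weight φ J ⊗ e[ J ]) ⊗ cycleSum (m ∸ a)
    cut : ∀ a → (∀ {a′} → a′ < a → Cut a′) → Cut a
    cut (suc a) rec (suc m) φ _ (s≤s a<m) = begin
      Σcomp (suc m) (λ I → V I (suc a) ⊗ (+ weight φ I ⊗ e[ I ]))
        ≡⟨ Σcomp-suc m (λ I → V I (suc a) ⊗ (+ weight φ I ⊗ e[ I ])) ⟩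
      Σ< (suc m) (λ c → Σcomp (m ∸ c) (λ J → V (suc c ∷ J) (suc a) ⊗ (+ weight φ (suc c ∷ J) ⊗ e[ suc c ∷ J ])))
        ≡⟨ Σ<-cong (suc m) (λ c → Σcomp-V-∷ (m ∸ c) c (suc a) φ) ⟩
      Σ< (suc m) (λ c → φE c ⊗ rest c)
        ≡⟨ Σ<-vanishing-tail (suc a) (suc m) _ (ℕₚ.<⇒≤ (s≤s a<m))
             (λ c a<c → trans (cong (φE c ⊗_) (Σcomp-V-∷-inside (m ∸ c) c a a<c)) (ℤₚ.*-zeroʳ (φE c))) ⟩
      Σ< (suc a) (λ c → φE c ⊗ rest c)
        ≡⟨ Σ<-cong-< (suc a) (λ c c≤a → trans (cong (φE c ⊗_) (rest-cut c c≤a)) (sym (ℤₚ.*-assoc (φE c) (ΠSum (a ∸ c)) (cycleSum (m ∸ a))))) ⟩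
      Σ< (suc a) (λ c → φE c ⊗ ΠSum (a ∸ c) ⊗ cycleSum (m ∸ a))
        ≡⟨ Σ<-*ʳ (suc a) (cycleSum (m ∸ a)) (λ c → φE c ⊗ ΠSum (a ∸ c)) ⟨
      Σ< (suc a) (λ c → φE c ⊗ ΠSum (a ∸ c)) ⊗ cycleSum (m ∸ a)
        ≡⟨ cong (_⊗ cycleSum (m ∸ a)) (Σcomp-first-part a φ (λ J → + weight φ J ⊗ e[ J ]) (λ c J → refl)) ⟨
      Σcomp (suc a) (λ J → + weight φ J ⊗ e[ J ]) ⊗ cycleSum (m ∸ a) ∎
      where
      φE rest : ℕ → ℤ
      φE   c = + φ (suc c) ⊗ E (suc c)
      rest c = Σcomp (m ∸ c) (λ J → V (suc c ∷ J) (suc a) ⊗ (+ Π⁻ J ⊗ e[ J ]))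
      rest-cut : ∀ c → c < suc a → rest c ≡ ΠSum (a ∸ c) ⊗ cycleSum (m ∸ a)
      rest-cut c (s≤s c≤a) with ℕₚ.m≤n⇒m<n∨m≡n c≤a
      ... | inj₁ c<a = begin
        rest c
          ≡⟨ Σcomp-V-∷-before (m ∸ c) c a c<a ⟩
        Σcomp (m ∸ c) (λ J → V J (a ∸ c) ⊗ (+ weight (λ i → i ∸ 1) J ⊗ e[ J ]))
          ≡⟨ rec (s≤s (ℕₚ.m∸n≤m a c)) (m ∸ c) (λ i → i ∸ 1) (ℕₚ.m<n⇒0<n∸m c<a) (ℕₚ.∸-monoˡ-< a<m (ℕₚ.<⇒≤ c<a)) ⟩
        Σcomp (a ∸ c) (λ J → + weight (λ i → i ∸ 1) J ⊗ e[ J ]) ⊗ cycleSum (m ∸ c ∸ (a ∸ c))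
          ≡⟨ cong₂ (λ s t → s ⊗ cycleSum t)
               (Σcomp-cong (a ∸ c) (λ J _ → cong (λ p → + p ⊗ e[ J ]) (sym (Π⁻≡weight-pred J))))
               (trans (ℕₚ.∸-+-assoc m c (a ∸ c)) (cong (m ∸_) (ℕₚ.m+[n∸m]≡n (ℕₚ.<⇒≤ c<a)))) ⟩
        ΠSum (a ∸ c) ⊗ cycleSum (m ∸ a) ∎
      ... | inj₂ refl = begin
        rest c                            ≡⟨ Σcomp-V-∷-end m c a<m ⟩
        cycleSum (m ∸ c)                  ≡⟨ ℤₚ.*-identityˡ (cycleSum (m ∸ c)) ⟨
        1ℤ ⊗ cycleSum (m ∸ c)             ≡⟨ cong (λ k → ΠSum k ⊗ cycleSum (m ∸ c)) (ℕₚ.n∸n≡0 c) ⟨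
        ΠSum (c ∸ c) ⊗ cycleSum (m ∸ c)   ∎

  ΘwSum-step : ∀ n a → 1 ≤ a → a < n → ΘwSum n (suc a) ≡ ΘwSum n a ⊕ wSum a ⊗ cycleSum (n ∸ a) ⊖ wSum n
  ΘwSum-step n a 1≤a a<n = begin
    ΘwSum n (suc a)
      ≡⟨ Σcomp-cong n (λ I _ → pointwise I) ⟩
    Σcomp n (λ I → + (Θrec I a * w I) ⊗ e[ I ] ⊕ V I a ⊗ (+ weight id I ⊗ e[ I ]) ⊖ + w I ⊗ e[ I ])
      ≡⟨ Σcomp-⊖ n _ _ ⟩
    Σcomp n (λ I → + (Θrec I a * w I) ⊗ e[ I ] ⊕ V I a ⊗ (+ weight id I ⊗ e[ I ])) ⊖ wSum n
      ≡⟨ cong (_⊖ wSum n) (Σcomp-+ n _ _) ⟩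
    ΘwSum n a ⊕ Σcomp n (λ I → V I a ⊗ (+ weight id I ⊗ e[ I ])) ⊖ wSum n
      ≡⟨ cong (λ t → ΘwSum n a ⊕ t ⊖ wSum n) (Σcomp-V a n id 1≤a a<n) ⟩
    ΘwSum n a ⊕ Σcomp a (λ J → + weight id J ⊗ e[ J ]) ⊗ cycleSum (n ∸ a) ⊖ wSum n
      ≡⟨ cong (λ t → ΘwSum n a ⊕ t ⊗ cycleSum (n ∸ a) ⊖ wSum n)
              (Σcomp-cong a (λ J _ → cong (λ p → + p ⊗ e[ J ]) (sym (w≡weight-id J)))) ⟩
    ΘwSum n a ⊕ wSum a ⊗ cycleSum (n ∸ a) ⊖ wSum n ∎
    where
    pointwise : ∀ I → + (Θrec I (suc a) * w I) ⊗ e[ I ]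
                      ≡ + (Θrec I a * w I) ⊗ e[ I ] ⊕ V I a ⊗ (+ weight id I ⊗ e[ I ]) ⊖ + w I ⊗ e[ I ]
    pointwise I = begin
      + (Θrec I (suc a) * w I) ⊗ e[ I ]
        ≡⟨ cong (_⊗ e[ I ]) (ℤₚ.pos-* (Θrec I (suc a)) (w I)) ⟩
      + Θrec I (suc a) ⊗ + w I ⊗ e[ I ]
        ≡⟨ telescope (+ Θrec I (suc a)) (+ Θrec I a) (+ w I) e[ I ] ⟩
      + Θrec I a ⊗ + w I ⊗ e[ I ] ⊕ V I a ⊗ (+ w I ⊗ e[ I ]) ⊖ + w I ⊗ e[ I ]
        ≡⟨ cong₂ (λ s t → s ⊗ e[ I ] ⊕ V I a ⊗ (+ t ⊗ e[ I ]) ⊖ + w I ⊗ e[ I ])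
                 (sym (ℤₚ.pos-* (Θrec I a) (w I))) (w≡weight-id I) ⟩
      + (Θrec I a * w I) ⊗ e[ I ] ⊕ V I a ⊗ (+ weight id I ⊗ e[ I ]) ⊖ + w I ⊗ e[ I ] ∎
      where
      telescope : ∀ p q r s → p ⊗ r ⊗ s ≡ q ⊗ r ⊗ s ⊕ (p ⊖ q ⊕ 1ℤ) ⊗ (r ⊗ s) ⊖ r ⊗ s
      telescope = solve-∀

  ΘwSum-diagonal : ∀ n → ΘwSum n n ≡ 0ℤ
  ΘwSum-diagonal n = trans (Σcomp-cong n vanishes) (Σcomp-zero n)
    where
    vanishes : ∀ I → sum I ≡ n → + (Θrec I n * w I) ⊗ e[ I ] ≡ 0ℤ
    vanishes I refl = cong (λ t → + (t * w I) ⊗ e[ I ]) (Θrec-sum I)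

  -- The recurrence on the colouring side

  apart together : ℕ → List ℕ → ℤ
  apart    p κ = 𝟙[ not (nth κ 0 ≡ᵇ nth κ p) ∧ smirnov κ ] monomial κ
  together p κ = 𝟙[ (nth κ 0 ≡ᵇ nth κ p) ∧ smirnov κ ] monomial κ

  Xapart Xtogether : ℕ → ℕ → ℤ
  Xapart    n p = Σw N n (apart p)
  Xtogether n p = Σw N n (together p)

  X-tadpole : ∀ n l → X (tadpole n l) N x ≡ Xapart n (n ∸ l ∸ 1)
  X-tadpole n l = Σw-cong-length N n (λ κ len → cong (𝟙[_] monomial κ) (proper-tadpole n l κ len))

  XP-split : ∀ n p → XP n ≡ Xapart n p ⊕ Xtogether n p
  XP-split n p = trans (Σw-cong N n (λ κ → 𝟙-split (nth κ 0 ≡ᵇ nth κ p) (smirnov κ) (monomial κ)))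
                       (Σw-+ N n (apart p) (together p))

  monomial-++ : ∀ u v → monomial (u ++ v) ≡ monomial u ⊗ monomial v
  monomial-++ []      v = sym (ℤₚ.*-identityˡ (monomial v))
  monomial-++ (a ∷ u) v = trans (cong (x a ⊗_) (monomial-++ u v)) (sym (ℤₚ.*-assoc (x a) (monomial u) (monomial v)))

  Σcut : ℕ → ℕ → (List ℕ → ℕ → ℕ → List ℕ → ℤ) → ℤ
  Σcut q l F = Σw N q (λ u → Σ< N (λ b → Σ< N (λ b′ → Σw N l (λ s → F u b b′ s))))

  Σcut-cong : ∀ q l {F G} → (∀ u b b′ s → length u ≡ q → F u b b′ s ≡ G u b b′ s) → Σcut q l F ≡ Σcut q l G
  Σcut-cong q l eq = Σw-cong-length N q (λ u len → Σ<-cong N (λ b → Σ<-cong N (λ b′ → Σw-cong N l (λ s → eq u b b′ s len))))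

  Σcut-+ : ∀ q l F G → Σcut q l (λ u b b′ s → F u b b′ s ⊕ G u b b′ s) ≡ Σcut q l F ⊕ Σcut q l G
  Σcut-+ q l F G = trans (Σw-cong N q (λ u → trans (Σ<-cong N (λ b → trans
      (Σ<-cong N (λ b′ → Σw-+ N l (F u b b′) (G u b b′)))
      (Σ<-+ N (λ b′ → Σw N l (F u b b′)) (λ b′ → Σw N l (G u b b′)))))
      (Σ<-+ N (λ b → Σ< N (λ b′ → Σw N l (F u b b′))) (λ b → Σ< N (λ b′ → Σw N l (G u b b′))))))
    (Σw-+ N q (λ u → Σcut-inner F u) (λ u → Σcut-inner G u))
    where
    Σcut-inner : (List ℕ → ℕ → ℕ → List ℕ → ℤ) → List ℕ → ℤ
    Σcut-inner H u = Σ< N (λ b → Σ< N (λ b′ → Σw N l (H u b b′)))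

  Σw-cut-middle : ∀ q l f → Σw N (q + suc (suc l)) f ≡ Σcut q l (λ u b b′ s → f (u ++ b ∷ b′ ∷ s))
  Σw-cut-middle q l f = trans (Σw-++ N q (suc (suc l)) f) (Σw-cong N q (λ u → trans (Σw-suc N (suc l) (λ t → f (u ++ t)))
    (Σ<-cong N (λ b → Σw-suc N l (λ t → f (u ++ b ∷ t))))))

  Σw-cut-front : ∀ q l f → Σw N (suc (q + suc l)) f ≡ Σcut q l (λ u b b′ s → f (b ∷ u ++ b′ ∷ s))
  Σw-cut-front q l f = begin
    Σw N (suc (q + suc l)) f
      ≡⟨ Σw-suc N (q + suc l) f ⟩
    Σ< N (λ b → Σw N (q + suc l) (λ r → f (b ∷ r)))
      ≡⟨ Σ<-cong N (λ b → trans (Σw-++ N q (suc l) (λ r → f (b ∷ r))) (Σw-cong N q (λ u → Σw-suc N l (λ t → f (b ∷ u ++ t))))) ⟩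
    Σ< N (λ b → Σw N q (λ u → Σ< N (λ b′ → Σw N l (λ s → f (b ∷ u ++ b′ ∷ s)))))
      ≡⟨ Σ<-Σ∈-swap N (words N q) (λ b u → Σ< N (λ b′ → Σw N l (λ s → f (b ∷ u ++ b′ ∷ s)))) ⟩
    Σcut q l (λ u b b′ s → f (b ∷ u ++ b′ ∷ s)) ∎

  Xapart⊗XP : ∀ q l → Xapart (suc q) q ⊗ XP (suc l) ≡ Σcut q l (λ u b b′ s → apart q (u ++ b ∷ []) ⊗ path-term (b′ ∷ s))
  Xapart⊗XP q l = begin
    Xapart (suc q) q ⊗ XP (suc l)
      ≡⟨ cong (_⊗ XP (suc l)) cycle-last ⟩
    Σw N q (λ u → Σ< N (λ b → apart q (u ++ b ∷ []))) ⊗ XP (suc l)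
      ≡⟨ Σw-*ʳ N q _ (XP (suc l)) ⟩
    Σw N q (λ u → Σ< N (λ b → apart q (u ++ b ∷ [])) ⊗ XP (suc l))
      ≡⟨ Σw-cong N q (λ u → trans (Σ<-*ʳ N (XP (suc l)) _) (Σ<-cong N (λ b → distribute (apart q (u ++ b ∷ []))))) ⟩
    Σcut q l (λ u b b′ s → apart q (u ++ b ∷ []) ⊗ path-term (b′ ∷ s)) ∎
    where
    cycle-last : Xapart (suc q) q ≡ Σw N q (λ u → Σ< N (λ b → apart q (u ++ b ∷ [])))
    cycle-last = trans (cong (λ n → Σw N n (apart q)) (ℕₚ.+-comm 1 q)) (trans (Σw-++ N q 1 (apart q))
      (Σw-cong N q (λ u → trans (Σw-suc N 0 (λ t → apart q (u ++ t))) (Σ<-cong N (λ b → Σw-zero N (λ t → apart q (u ++ b ∷ t)))))))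
    distribute : ∀ c → c ⊗ XP (suc l) ≡ Σ< N (λ b′ → Σw N l (λ s → c ⊗ path-term (b′ ∷ s)))
    distribute c = trans (cong (c ⊗_) (Σw-suc N l path-term))
      (trans (Σ<-*ˡ N c _) (Σ<-cong N (λ b′ → Σw-*ˡ N l (λ s → path-term (b′ ∷ s)) c)))

  glue-≢ : ∀ q u b b′ s → length u ≡ q → (b ≡ᵇ b′) ≡ false →
    apart q (u ++ b ∷ []) ⊗ path-term (b′ ∷ s) ≡ apart q (u ++ b ∷ b′ ∷ s) ⊕ together (suc q) (b ∷ u ++ b′ ∷ s)
  glue-≢ q u b b′ s len b≢b′ = begin
    apart q (u ++ b ∷ []) ⊗ path-term (b′ ∷ s)
      ≡⟨ 𝟙-* _ B (monomial (u ++ b ∷ [])) (monomial (b′ ∷ s)) ⟩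
    𝟙[ (not (h ≡ᵇ nth (u ++ b ∷ []) q) ∧ S) ∧ B ] (monomial (u ++ b ∷ []) ⊗ monomial (b′ ∷ s))
      ≡⟨ cong₂ 𝟙[_]_ colours monomial-glue ⟩
    apart q κ
      ≡⟨ ℤₚ.+-identityʳ _ ⟨
    apart q κ ⊕ 0ℤ
      ≡⟨ cong (apart q κ ⊕_) no-return ⟨
    apart q κ ⊕ together (suc q) (b ∷ u ++ b′ ∷ s) ∎
    where
    no-return : together (suc q) (b ∷ u ++ b′ ∷ s) ≡ 0ℤ
    no-return = cong (λ t → 𝟙[ t ∧ smirnov (b ∷ u ++ b′ ∷ s) ] monomial (b ∷ u ++ b′ ∷ s))
                     (trans (cong (b ≡ᵇ_) (nth-++-length u q b′ s len)) b≢b′)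
    κ : List ℕ
    κ = u ++ b ∷ b′ ∷ s
    h : ℕ
    h = nth (u ++ b ∷ []) 0
    S B : Bool
    S = smirnov (u ++ b ∷ [])
    B = smirnov (b′ ∷ s)
    monomial-glue : monomial (u ++ b ∷ []) ⊗ monomial (b′ ∷ s) ≡ monomial κ
    monomial-glue = begin
      monomial (u ++ b ∷ []) ⊗ (x b′ ⊗ monomial s)
        ≡⟨ cong (_⊗ (x b′ ⊗ monomial s)) (monomial-++ u (b ∷ [])) ⟩
      monomial u ⊗ (x b ⊗ 1ℤ) ⊗ (x b′ ⊗ monomial s)
        ≡⟨ regroup (monomial u) (x b) (x b′) (monomial s) ⟩
      monomial u ⊗ (x b ⊗ (x b′ ⊗ monomial s))
        ≡⟨ monomial-++ u (b ∷ b′ ∷ s) ⟨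
      monomial (u ++ b ∷ b′ ∷ s) ∎
      where
      regroup : ∀ p q r t → p ⊗ (q ⊗ 1ℤ) ⊗ (r ⊗ t) ≡ p ⊗ (q ⊗ (r ⊗ t))
      regroup = solve-∀
    colours : ((not (h ≡ᵇ nth (u ++ b ∷ []) q) ∧ S) ∧ B) ≡ (not (nth κ 0 ≡ᵇ nth κ q) ∧ smirnov κ)
    colours = begin
      (not (h ≡ᵇ nth (u ++ b ∷ []) q) ∧ S) ∧ B
        ≡⟨ cong (λ t → (not (h ≡ᵇ t) ∧ S) ∧ B) (nth-++-length u q b [] len) ⟩
      (not (h ≡ᵇ b) ∧ S) ∧ B
        ≡⟨ ∧-assoc (not (h ≡ᵇ b)) S B ⟩
      not (h ≡ᵇ b) ∧ (S ∧ B)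
        ≡⟨ cong₂ (λ i j → not (i ≡ᵇ j) ∧ (S ∧ B))
                                                                 (nth-++-0 u b (b′ ∷ s)) (nth-++-length u q b (b′ ∷ s) len) ⟨
      not (nth κ 0 ≡ᵇ nth κ q) ∧ (S ∧ B)
        ≡⟨ cong (λ t → not (nth κ 0 ≡ᵇ nth κ q) ∧ (S ∧ (not t ∧ B))) b≢b′ ⟨
      not (nth κ 0 ≡ᵇ nth κ q) ∧ (S ∧ smirnov (b ∷ b′ ∷ s))
        ≡⟨ cong (not (nth κ 0 ≡ᵇ nth κ q) ∧_) (smirnov-++ u b (b′ ∷ s)) ⟨
      not (nth κ 0 ≡ᵇ nth κ q) ∧ smirnov κ ∎

  apart-repeated : ∀ q u b s → apart q (u ++ b ∷ b ∷ s) ≡ 0ℤ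
  apart-repeated q u b s = cong (𝟙[_] monomial (u ++ b ∷ b ∷ s)) (begin
    d ∧ smirnov (u ++ b ∷ b ∷ s)
      ≡⟨ cong (d ∧_) (smirnov-++ u b (b ∷ s)) ⟩
    d ∧ (smirnov (u ++ b ∷ []) ∧ (not (b ≡ᵇ b) ∧ smirnov (b ∷ s)))
      ≡⟨ cong (λ t → d ∧ (smirnov (u ++ b ∷ []) ∧ (not t ∧ smirnov (b ∷ s)))) (≡ᵇ-refl b) ⟩
    d ∧ (smirnov (u ++ b ∷ []) ∧ false)
      ≡⟨ cong (d ∧_) (∧-zeroʳ (smirnov (u ++ b ∷ []))) ⟩
    d ∧ false
      ≡⟨ ∧-zeroʳ d ⟩
    false ∎)
    where
    d : Bool
    d = not (nth (u ++ b ∷ b ∷ s) 0 ≡ᵇ nth (u ++ b ∷ b ∷ s) q)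

  glue-≡ : ∀ q u b s → length u ≡ q →
    apart q (u ++ b ∷ []) ⊗ path-term (b ∷ s) ≡ apart q (u ++ b ∷ b ∷ s) ⊕ together (suc q) (b ∷ u ++ b ∷ s)
  glue-≡ q u b s len = begin
    apart q (u ++ b ∷ []) ⊗ path-term (b ∷ s)
      ≡⟨ 𝟙-* _ B (monomial (u ++ b ∷ [])) (monomial (b ∷ s)) ⟩
    𝟙[ (not (h ≡ᵇ nth (u ++ b ∷ []) q) ∧ S) ∧ B ] (monomial (u ++ b ∷ []) ⊗ monomial (b ∷ s))
      ≡⟨ cong₂ 𝟙[_]_ colours monomial-glue ⟩
    together (suc q) (b ∷ u ++ b ∷ s)
      ≡⟨ ℤₚ.+-identityˡ _ ⟨
    0ℤ ⊕ together (suc q) (b ∷ u ++ b ∷ s)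
      ≡⟨ cong (_⊕ together (suc q) (b ∷ u ++ b ∷ s)) (apart-repeated q u b s) ⟨
    apart q (u ++ b ∷ b ∷ s) ⊕ together (suc q) (b ∷ u ++ b ∷ s) ∎
    where
    h : ℕ
    h = nth (u ++ b ∷ []) 0
    S B : Bool
    S = smirnov (u ++ b ∷ [])
    B = smirnov (b ∷ s)
    monomial-glue : monomial (u ++ b ∷ []) ⊗ monomial (b ∷ s) ≡ monomial (b ∷ u ++ b ∷ s)
    monomial-glue = begin
      monomial (u ++ b ∷ []) ⊗ (x b ⊗ monomial s)
        ≡⟨ cong (_⊗ (x b ⊗ monomial s)) (monomial-++ u (b ∷ [])) ⟩
      monomial u ⊗ (x b ⊗ 1ℤ) ⊗ (x b ⊗ monomial s)
        ≡⟨ regroup (monomial u) (x b) (monomial s) ⟩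
      x b ⊗ (monomial u ⊗ (x b ⊗ monomial s))
        ≡⟨ cong (x b ⊗_) (monomial-++ u (b ∷ s)) ⟨
      monomial (b ∷ u ++ b ∷ s) ∎
      where
      regroup : ∀ p q t → p ⊗ (q ⊗ 1ℤ) ⊗ (q ⊗ t) ≡ q ⊗ (p ⊗ (q ⊗ t))
      regroup = solve-∀
    colours : ((not (h ≡ᵇ nth (u ++ b ∷ []) q) ∧ S) ∧ B) ≡ ((b ≡ᵇ nth (u ++ b ∷ s) q) ∧ smirnov (b ∷ u ++ b ∷ s))
    colours = begin
      (not (h ≡ᵇ nth (u ++ b ∷ []) q) ∧ S) ∧ B
        ≡⟨ cong (λ t → (not (h ≡ᵇ t) ∧ S) ∧ B) (nth-++-length u q b [] len) ⟩
      (not (h ≡ᵇ b) ∧ S) ∧ B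
        ≡⟨ cong (_∧ B) (smirnov-∷-++ u b b) ⟨
      smirnov (b ∷ u ++ b ∷ []) ∧ B
        ≡⟨ smirnov-++ (b ∷ u) b s ⟨
      smirnov (b ∷ u ++ b ∷ s)
        ≡⟨ cong (_∧ smirnov (b ∷ u ++ b ∷ s)) (≡ᵇ-refl b) ⟨
      (b ≡ᵇ b) ∧ smirnov (b ∷ u ++ b ∷ s)
        ≡⟨ cong (λ t → (b ≡ᵇ t) ∧ smirnov (b ∷ u ++ b ∷ s)) (nth-++-length u q b s len) ⟨
      (b ≡ᵇ nth (u ++ b ∷ s) q) ∧ smirnov (b ∷ u ++ b ∷ s) ∎

  glue : ∀ q u b b′ s → length u ≡ q →
    apart q (u ++ b ∷ []) ⊗ path-term (b′ ∷ s) ≡ apart q (u ++ b ∷ b′ ∷ s) ⊕ together (suc q) (b ∷ u ++ b′ ∷ s)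
  glue q u b b′ s len with b ≡ᵇ b′ in b≟b′
  ... | false = glue-≢ q u b b′ s len b≟b′
  ... | true  rewrite ℕₚ.≡ᵇ⇒≡ b b′ (subst T (sym b≟b′) tt) = glue-≡ q u b′ s len

  -- Colour the cycle C_{q+1} by u b and the path P_{l+1} by b′ s. If b ≠ b′ then u b b′ s is a
  -- Smirnov word with distinct letters at 0 and q; if b = b′ then b u b s is a Smirnov word with
  -- equal letters at 0 and q+1, and each such word arises exactly once.
  cycle⊗path : ∀ q l → Xapart (suc q) q ⊗ XP (suc l) ≡ Xapart (q + suc (suc l)) q ⊕ Xtogether (q + suc (suc l)) (suc q)
  cycle⊗path q l = begin
    Xapart (suc q) q ⊗ XP (suc l)
      ≡⟨ Xapart⊗XP q l ⟩
    Σcut q l (λ u b b′ s → apart q (u ++ b ∷ []) ⊗ path-term (b′ ∷ s))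
      ≡⟨ Σcut-cong q l (glue q) ⟩
    Σcut q l (λ u b b′ s → apart q (u ++ b ∷ b′ ∷ s) ⊕ together (suc q) (b ∷ u ++ b′ ∷ s))
      ≡⟨ Σcut-+ q l (λ u b b′ s → apart q (u ++ b ∷ b′ ∷ s)) (λ u b b′ s → together (suc q) (b ∷ u ++ b′ ∷ s)) ⟩
    Σcut q l (λ u b b′ s → apart q (u ++ b ∷ b′ ∷ s)) ⊕ Σcut q l (λ u b b′ s → together (suc q) (b ∷ u ++ b′ ∷ s))
      ≡⟨ cong₂ _⊕_ (Σw-cut-middle q l (apart q)) (trans (cong (λ n → Σw N n (together (suc q))) (ℕₚ.+-suc q (suc l)))
                                                        (Σw-cut-front q l (together (suc q)))) ⟨
    Xapart (q + suc (suc l)) q ⊕ Xtogether (q + suc (suc l)) (suc q) ∎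

  Xapart-step : ∀ q l → Xapart (q + suc (suc l)) (suc q)
                        ≡ Xapart (q + suc (suc l)) q ⊕ XP (q + suc (suc l)) ⊖ Xapart (suc q) q ⊗ XP (suc l)
  Xapart-step q l = begin
    Xapart n (suc q)
      ≡⟨ cancel (Xapart n (suc q)) (Xapart n q) (Xtogether n (suc q)) ⟨
    Xapart n q ⊕ (Xapart n (suc q) ⊕ Xtogether n (suc q)) ⊖ (Xapart n q ⊕ Xtogether n (suc q))
      ≡⟨ cong₂ (λ s t → Xapart n q ⊕ s ⊖ t) (XP-split n (suc q)) (cycle⊗path q l) ⟨
    Xapart n q ⊕ XP n ⊖ Xapart (suc q) q ⊗ XP (suc l) ∎
    where
    n : ℕ
    n = q + suc (suc l)
    cancel : ∀ a b c → b ⊕ (a ⊕ c) ⊖ (b ⊕ c) ≡ a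
    cancel = solve-∀

  [q+2+l]∸[1+l]≡1+q : ∀ q l → q + suc (suc l) ∸ suc l ≡ suc q
  [q+2+l]∸[1+l]≡1+q q l = trans (cong (_∸ suc l) (ℕₚ.+-suc q (suc l))) (ℕₚ.m+n∸n≡m (suc q) (suc l))

  TadpoleFormula : ℕ → ℕ → Set
  TadpoleFormula n l = X (tadpole n l) N x ≡ ΘwSum n (suc l)

  tadpole-base : ∀ l → TadpoleFormula (suc l) l
  tadpole-base l = begin
    X (tadpole (suc l) l) N x
      ≡⟨ X-tadpole (suc l) l ⟩
    Xapart (suc l) (suc l ∸ l ∸ 1)
      ≡⟨ cong (λ p → Xapart (suc l) (p ∸ 1)) (ℕₚ.m+n∸n≡m 1 l) ⟩
    Xapart (suc l) 0
      ≡⟨ Σ∈-cong (words N (suc l)) (λ κ → cong (λ t → 𝟙[ not t ∧ smirnov κ ] monomial κ) (≡ᵇ-refl (nth κ 0))) ⟩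
    Σw N (suc l) (λ _ → 0ℤ)
      ≡⟨ Σ∈-zero (words N (suc l)) ⟩
    0ℤ
      ≡⟨ ΘwSum-diagonal (suc l) ⟨
    ΘwSum (suc l) (suc l) ∎

  tadpole-recurrence : ∀ q l →
    X (tadpole (q + suc (suc l)) l) N x
    ≡ X (tadpole (q + suc (suc l)) (suc l)) N x ⊕ XP (q + suc (suc l)) ⊖ X (tadpole (suc q) 0) N x ⊗ XP (suc l)
  tadpole-recurrence q l = begin
    X (tadpole n l) N x
      ≡⟨ X-tadpole n l ⟩
    Xapart n (n ∸ l ∸ 1)
      ≡⟨ cong (Xapart n) (trans (ℕₚ.∸-+-assoc n l 1) (cong (n ∸_) (ℕₚ.+-comm l 1))) ⟩
    Xapart n (n ∸ suc l)
      ≡⟨ cong (Xapart n) ([q+2+l]∸[1+l]≡1+q q l) ⟩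
    Xapart n (suc q)
      ≡⟨ Xapart-step q l ⟩
    Xapart n q ⊕ XP n ⊖ Xapart (suc q) q ⊗ XP (suc l)
      ≡⟨ cong (λ p → Xapart n (p ∸ 1) ⊕ XP n ⊖ Xapart (suc q) q ⊗ XP (suc l)) ([q+2+l]∸[1+l]≡1+q q l) ⟨
    Xapart n (n ∸ suc l ∸ 1) ⊕ XP n ⊖ Xapart (suc q) q ⊗ XP (suc l)
      ≡⟨ cong₂ (λ s t → s ⊕ XP n ⊖ t ⊗ XP (suc l)) (X-tadpole n (suc l)) (X-tadpole (suc q) 0) ⟨
    X (tadpole n (suc l)) N x ⊕ XP n ⊖ X (tadpole (suc q) 0) N x ⊗ XP (suc l) ∎
    where
    n : ℕ
    n = q + suc (suc l)

  ΘwSum-recurrence : ∀ q l →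
    ΘwSum (q + suc (suc l)) (suc l)
    ≡ ΘwSum (q + suc (suc l)) (suc (suc l)) ⊕ wSum (q + suc (suc l)) ⊖ cycleSum (suc q) ⊗ wSum (suc l)
  ΘwSum-recurrence q l = begin
    ΘwSum n (suc l)
      ≡⟨ cancel (ΘwSum n (suc l)) (wSum (suc l)) (cycleSum (suc q)) (wSum n) ⟨
    ΘwSum n (suc l) ⊕ wSum (suc l) ⊗ cycleSum (suc q) ⊖ wSum n ⊕ wSum n ⊖ cycleSum (suc q) ⊗ wSum (suc l)
      ≡⟨ cong (λ m → ΘwSum n (suc l) ⊕ wSum (suc l) ⊗ cycleSum m ⊖ wSum n ⊕ wSum n ⊖ cycleSum (suc q) ⊗ wSum (suc l))
              ([q+2+l]∸[1+l]≡1+q q l) ⟨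
    ΘwSum n (suc l) ⊕ wSum (suc l) ⊗ cycleSum (n ∸ suc l) ⊖ wSum n ⊕ wSum n ⊖ cycleSum (suc q) ⊗ wSum (suc l)
      ≡⟨ cong (λ t → t ⊕ wSum n ⊖ cycleSum (suc q) ⊗ wSum (suc l)) (ΘwSum-step n (suc l) (s≤s z≤n) 1+l<n) ⟨
    ΘwSum n (suc (suc l)) ⊕ wSum n ⊖ cycleSum (suc q) ⊗ wSum (suc l) ∎
    where
    n : ℕ
    n = q + suc (suc l)
    1+l<n : suc l < n
    1+l<n = subst (suc l <_) (sym (ℕₚ.+-suc q (suc l))) (s≤s (ℕₚ.m≤n+m (suc l) q))
    cancel : ∀ a b c d → a ⊕ b ⊗ c ⊖ d ⊕ d ⊖ c ⊗ b ≡ a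
    cancel = solve-∀

  tadpole-step : ∀ q l → TadpoleFormula (q + suc (suc l)) (suc l) → TadpoleFormula (suc q) 0 → TadpoleFormula (q + suc (suc l)) l
  tadpole-step q l longer-tail cycle = begin
    X (tadpole n l) N x
      ≡⟨ tadpole-recurrence q l ⟩
    X (tadpole n (suc l)) N x ⊕ XP n ⊖ X (tadpole (suc q) 0) N x ⊗ XP (suc l)
      ≡⟨ cong₂ (λ s t → s ⊕ XP n ⊖ t ⊗ XP (suc l)) longer-tail cycle ⟩
    ΘwSum n (suc (suc l)) ⊕ XP n ⊖ cycleSum (suc q) ⊗ XP (suc l)
      ≡⟨ cong₂ (λ s t → ΘwSum n (suc (suc l)) ⊕ s ⊖ cycleSum (suc q) ⊗ t) (XP≗wSum n) (XP≗wSum (suc l)) ⟩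
    ΘwSum n (suc (suc l)) ⊕ wSum n ⊖ cycleSum (suc q) ⊗ wSum (suc l)
      ≡⟨ ΘwSum-recurrence q l ⟨
    ΘwSum n (suc l) ∎
    where
    n : ℕ
    n = q + suc (suc l)

  tadpole-formula : ∀ d l → TadpoleFormula (d + suc l) l
  tadpole-formula zero    l = tadpole-base l
  tadpole-formula (suc d) l = subst (λ n → TadpoleFormula n l) (ℕₚ.+-suc d (suc l))
    (tadpole-step d l (tadpole-formula d (suc l)) (subst (λ n → TadpoleFormula n 0) (ℕₚ.+-comm d 1) (tadpole-formula d 0)))

  ΘwSum-compositions : ∀ n l → Σ∈ (compositions n) (λ I → + (Θ⁺ I (l + 1) * w I) ⊗ e[ I ]) ≡ ΘwSum n (suc l)
  ΘwSum-compositions n l = trans (Σ∈-compositions n _) (Σcomp-cong n (λ I _ →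
    cong (λ t → + (t * w I) ⊗ e[ I ]) (trans (cong (Θ⁺ I) (ℕₚ.+-comm l 1)) (Θ⁺≡Θrec I l))))

theorem3p3 : (n l : ℕ) → 2 + l ≤ n → (N : ℕ) → (x : ℕ → ℤ) →
    X (tadpole n l) N x ≡
      foldr ℤ._+_ (+ 0)
        (map (λ I → (+ (Θ⁺ I (l + 1) * w I)) ℤ.* eI I N x) (compositions n))
theorem3p3 n l 2+l≤n N x = begin
  X (tadpole n l) N x
    ≡⟨ subst (λ m → TadpoleFormula N x m l) (ℕₚ.m∸n+n≡m (ℕₚ.<⇒≤ 2+l≤n)) (tadpole-formula N x (n ∸ suc l) l) ⟩
  ΘwSum N x n (suc l)
    ≡⟨ ΘwSum-compositions N x n l ⟨
  Σ∈ (compositions n) (λ I → + (Θ⁺ I (l + 1) * w I) ⊗ eI I N x) ∎
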